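{- For all $n\ge 3$, $$\beta(P_{2\infty}\Box C_n)=\begin{cases}3 & \text{if } n \text{ is odd},\\ 4 & \text{if } n \text{ is even},\end{cases}$$ and $S_1=\{(0,0),(0,\tfrac{n-1}{2}),(1,0)\}$ is a metric basis of $P_{2\infty}\Box C_n$ if $n$ is odd, and $S_2=\{(0,0),(0,\tfrac n2),(0,1),(1,0)\}$ is a metric basis if $n$ is even.
   Context: $P_{2\infty}$ has vertex set $\mathbb{Z}$ with $i,j$ adjacent iff $|i-j|=1$. $C_n$ has vertex set $\{0,1,\dots,n-1\}$ with $0\le i\le j\le n-1$ adjacent iff $j-i=1$ or $j-i=n-1$. The cartesian product $G\Box H$ has vertex set $V(G)\times V(H)$, with $(a,v)$ adjacent to $(b,w)$ iff either $a=b$ and $vw\in E(H)$, or $v=w$ and $ab\in E(G)$. $d$ is the shortest-path distance. A vertex $x$ resolves $u,v$ if $d(u,x)\neq d(v,x)$; a set $S$ is a resolving set if every pair of distinct vertices is resolved by some vertex of $S$; a metric basis is a resolving set of minimum cardinality and $\beta$ (metric dimension) is its cardinality (infinite if no finite resolving set exists). -}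

module Defs where

open import Data.Nat using (ℕ; zero; suc; _≤_; _∸_)
open import Data.Integer using (ℤ; _-_; ∣_∣)
open import Data.Fin using (Fin; toℕ)
open import Data.Product using (_×_; Σ; ∃; _,_)
open import Data.Sum using (_⊎_)
open import Data.List using (List; length)
open import Data.List.Relation.Unary.Any using (Any)
open import Data.List.Relation.Unary.Unique.Propositional using (Unique)
open import Relation.Binary.PropositionalEquality using (_≡_; _≢_)

module _ {V : Set} (Adj : V → V → Set) where

  data Walk : V → V → ℕ → Set where
    nil  : ∀ {u} → Walk u u 0
    cons : ∀ {u w v k} → Adj u w → Walk w v k → Walk u v (suc k)

  Dist : V → V → ℕ → Set
  Dist u v k = Walk u v k × (∀ m → Walk u v m → k ≤ m)

  Resolves : V → V → V → Set
  Resolves x u v = ∀ k k' → Dist u x k → Dist v x k' → k ≢ k'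

  Resolving : List V → Set
  Resolving S = ∀ u v → u ≢ v → Any (λ x → Resolves x u v) S

  -- S (a list without repetitions, so |S| = length S) is a metric basis:
  -- resolving, and of minimum cardinality among finite resolving sets
  IsMetricBasis : List V → Set
  IsMetricBasis S = Unique S × Resolving S × (∀ L → Resolving L → length S ≤ length L)

  MetricDim : ℕ → Set
  MetricDim k = Σ (List V) (λ S → IsMetricBasis S × length S ≡ k)

PAdj : ℤ → ℤ → Set
PAdj i j = ∣ i - j ∣ ≡ 1

-- C_n: vertex set {0,…,n-1}; i ≤ j adjacent iff j-i = 1 or j-i = n-1
COrdAdj : (n : ℕ) → Fin n → Fin n → Set
COrdAdj n a b = (toℕ a ≤ toℕ b) × ((toℕ b ∸ toℕ a ≡ 1) ⊎ (toℕ b ∸ toℕ a ≡ n ∸ 1))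

CAdj : (n : ℕ) → Fin n → Fin n → Set
CAdj n a b = COrdAdj n a b ⊎ COrdAdj n b a

PCV : ℕ → Set
PCV n = ℤ × Fin n

PCAdj : (n : ℕ) → PCV n → PCV n → Set
PCAdj n (a , v) (b , w) = ((a ≡ b) × CAdj n v w) ⊎ ((v ≡ w) × PAdj a b)

module Submission where

-- (1) A function D that vanishes on the diagonal, grows by at most one along
--     an edge and is realised by walks is the graph distance; a list fails to
--     resolve as soon as two distinct vertices have equal distances to all
--     its members ("Confused").
-- (2) In the grid D((a,i),(b,j)) = |a - b| + tent(|i - j|), where
--     tent t = min(t, n ∸ t).  How the distances from a column and from its
--     two neighbours compare is read off the tent at column 0 and carried to
--     every column by the rotations of C_n (module Grid).
-- (3) Lower bounds (Confusion, EvenConfusion): with landmark levels written as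
--     offsets above a common base, confused pairs come from a cut across an
--     edge of C_n between two levels, a sandwich around one landmark level, or
--     two columns equidistant from all landmark columns.  Two landmarks are
--     always confused, and three are when n is even (C_n is bipartite).
-- (4) Upper bounds (OddCase, EvenCase): distances to the given landmarks
--     determine |a| and the column, and then the level a.

open import Defs
open import Data.Nat using (ℕ; zero; suc; _+_; _*_; _∸_; _⊓_; ∣_-_∣; _/_; _%_; _≤_; _<_; _≤?_; _<?_; _≟_; z≤n; s≤s; compare; less; equal; greater)
open import Data.Nat.Properties
open import Data.Nat.DivMod using (m≡m%n+[m/n]*n; m*n/n≡m)
import Data.Nat.Tactic.RingSolver as ℕRing
import Data.Integer as ℤ
open ℤ using (ℤ; +_; -[1+_]; 0ℤ; 1ℤ; ∣_∣)
import Data.Integer.Properties as ℤP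
import Data.Integer.Tactic.RingSolver as ℤRing
open import Data.Fin as Fin using (Fin; toℕ; fromℕ<; fromℕ)
open import Data.Fin.Properties using (toℕ-fromℕ<; toℕ-fromℕ; toℕ-injective; toℕ<n)
open import Data.Product using (_×_; _,_; proj₁; proj₂; Σ; ∃)
open import Data.Sum using (_⊎_; inj₁; inj₂)
open import Data.List using (List; []; _∷_; _++_; length; replicate; map)
open import Data.List.Properties using (length-++; length-replicate)
import Data.List.Relation.Unary.All as All
open All using (All; []; _∷_)
open import Data.List.Relation.Unary.All.Properties using (++⁻ˡ; map⁺)
open import Data.List.Relation.Unary.Any using (Any; here; there)
open import Data.List.Relation.Unary.AllPairs using ([]; _∷_)
open import Data.List.Relation.Unary.Unique.Propositional using (Unique)
open import Data.List.Relation.Binary.Permutation.Propositional using (_↭_; ↭-refl; ↭-prep; ↭-swap; ↭-trans)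
open import Data.List.Relation.Binary.Permutation.Propositional.Properties using (All-resp-↭)
open import Relation.Binary.PropositionalEquality
open import Relation.Nullary using (¬_; yes; no)
open import Data.Empty using (⊥-elim)

module _ {V : Set} {Adj : V → V → Set} where

  _++ʷ_ : ∀ {u w v k m} → Walk Adj u w k → Walk Adj w v m → Walk Adj u v (k + m)
  nil      ++ʷ q = q
  cons a p ++ʷ q = cons a (p ++ʷ q)

  private
    snocʷ : ∀ {u w v k} → Walk Adj u w k → Adj w v → Walk Adj u v (suc k)
    snocʷ nil        a = cons a nil
    snocʷ (cons b p) a = cons b (snocʷ p a)

  reverseʷ : (∀ {u v} → Adj u v → Adj v u) → ∀ {u v k} → Walk Adj u v k → Walk Adj v u k
  reverseʷ sym-adj nil        = nil
  reverseʷ sym-adj (cons a p) = snocʷ (reverseʷ sym-adj p) (sym-adj a)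

module DistanceFunction {V : Set} (Adj : V → V → Set)
    (D : V → V → ℕ)
    (D-refl : ∀ u → D u u ≡ 0)
    (D-step : ∀ u w v → Adj u w → D u v ≤ suc (D w v))
    (D-walk : ∀ u v → Walk Adj u v (D u v)) where

  D≤length : ∀ {u v m} → Walk Adj u v m → D u v ≤ m
  D≤length {u} nil rewrite D-refl u = ≤-refl
  D≤length {u} {v} (cons {w = w} a p) = ≤-trans (D-step u w v a) (s≤s (D≤length p))

  D-dist : ∀ u v → Dist Adj u v (D u v)
  D-dist u v = D-walk u v , λ m p → D≤length p

  dist⇒D : ∀ {u v k} → Dist Adj u v k → k ≡ D u v
  dist⇒D {u} {v} (p , minimal) = ≤-antisym (minimal (D u v) (D-walk u v)) (D≤length p)

  resolves⇒D≢ : ∀ {x u v} → Resolves Adj x u v → D u x ≢ D v x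
  resolves⇒D≢ {x} {u} {v} r = r (D u x) (D v x) (D-dist u x) (D-dist v x)

  D≢⇒resolves : ∀ {x u v} → D u x ≢ D v x → Resolves Adj x u v
  D≢⇒resolves ne k k' du dv k≡k' rewrite dist⇒D du | dist⇒D dv = ne k≡k'

  Twins : List V → V → V → Set
  Twins L u u' = All (λ x → D u x ≡ D u' x) L

  Confused : List V → Set
  Confused L = Σ V λ u → Σ V λ u' → u ≢ u' × Twins L u u'

  confused-↭ : ∀ {L L'} → L ↭ L' → Confused L → Confused L'
  confused-↭ L↭L' (u , u' , u≢u' , twins) = u , u' , u≢u' , All-resp-↭ L↭L' twins

  confused⇒¬resolving : ∀ L → Confused L → ¬ Resolving Adj L
  confused⇒¬resolving L (u , u' , u≢u' , twins) res = unresolved (res u u' u≢u') twins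
    where
    unresolved : ∀ {L} → Any (λ x → Resolves Adj x u u') L → ¬ Twins L u u'
    unresolved (here r)  (e ∷ _)  = resolves⇒D≢ r e
    unresolved (there p) (_ ∷ es) = unresolved p es

  -- If every list of exactly k vertices is confused, every resolving list
  -- is longer than k (a shorter list is padded by repeating a vertex v).
  resolving-length : ∀ k → V → (∀ L → length L ≡ k → Confused L) →
                     ∀ L → Resolving Adj L → k < length L
  resolving-length k v all-confused L res with k <? length L
  ... | yes k<len = k<len
  ... | no k≮len with all-confused (L ++ replicate (k ∸ length L) v) padded-length
    where
    padded-length : length (L ++ replicate (k ∸ length L) v) ≡ k
    padded-length = begin
      length (L ++ replicate (k ∸ length L) v)       ≡⟨ length-++ L ⟩
      length L + length (replicate (k ∸ length L) v) ≡⟨ cong (λ m → length L + m) (length-replicate (k ∸ length L)) ⟩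
      length L + (k ∸ length L)                      ≡⟨ m+[n∸m]≡n (≮⇒≥ k≮len) ⟩
      k                                              ∎
      where open ≡-Reasoning
  ...   | u , u' , u≢u' , twins = ⊥-elim (confused⇒¬resolving L (u , u' , u≢u' , ++⁻ˡ L twins) res)

  separating⇒resolving : ∀ S → (∀ u v → Twins S u v → u ≡ v) → Resolving Adj S
  separating⇒resolving S separating u v u≢v = search S (λ twins → u≢v (separating u v twins))
    where
    search : ∀ L → ¬ Twins L u v → Any (λ x → Resolves Adj x u v) L
    search []      not-twins = ⊥-elim (not-twins [])
    search (x ∷ L) not-twins with D u x ≟ D v x
    ... | no ne = here (D≢⇒resolves ne)
    ... | yes e = there (search L (λ twins → not-twins (e ∷ twins)))

_↑_ : ℤ → ℕ → ℤ
a ↑ k = a ℤ.+ + k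

infixl 7 _↑_

↑-identity : ∀ a → a ↑ 0 ≡ a
↑-identity = ℤP.+-identityʳ

↑-↑ : ∀ a i j → a ↑ i ↑ j ≡ a ↑ (i + j)
↑-↑ a i j = ℤP.+-assoc a (+ i) (+ j)

∣a-a↑k∣ : ∀ a k → ∣ a ℤ.- a ↑ k ∣ ≡ k
∣a-a↑k∣ a k = trans (cong ∣_∣ (eq a (+ k))) (ℤP.∣-i∣≡∣i∣ (+ k))
  where
  eq : ∀ a c → a ℤ.- (a ℤ.+ c) ≡ ℤ.- c
  eq = ℤRing.solve-∀

∣a↑k-a∣ : ∀ a k → ∣ a ↑ k ℤ.- a ∣ ≡ k
∣a↑k-a∣ a k = trans (ℤP.∣i-j∣≡∣j-i∣ (a ↑ k) a) (∣a-a↑k∣ a k)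

∣a-a∣≡0 : ∀ a → ∣ a ℤ.- a ∣ ≡ 0
∣a-a∣≡0 a = cong ∣_∣ (ℤP.+-inverseʳ a)

∣a↑i-a↑j∣ : ∀ a i j → ∣ a ↑ i ℤ.- a ↑ j ∣ ≡ ∣ i - j ∣
∣a↑i-a↑j∣ a i j with ≤-total i j
... | inj₁ i≤j with m≤n⇒∃[o]m+o≡n i≤j
...   | k , refl rewrite sym (↑-↑ a i k) = trans (∣a-a↑k∣ (a ↑ i) k) (sym (∣m-m+n∣≡n i k))
∣a↑i-a↑j∣ a i j | inj₂ j≤i with m≤n⇒∃[o]m+o≡n j≤i
...   | k , refl rewrite sym (↑-↑ a j k) = trans (∣a↑k-a∣ (a ↑ j) k) (sym (trans (∣-∣-comm (j + k) j) (∣m-m+n∣≡n j k)))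

↑-injective : ∀ a i j → a ↑ i ≡ a ↑ j → i ≡ j
↑-injective a i j e = ∣m-n∣≡0⇒m≡n (trans (sym (∣a↑i-a↑j∣ a i j)) (trans (cong (λ b → ∣ b ℤ.- a ↑ j ∣) e) (∣a-a∣≡0 (a ↑ j))))

level-compare : ∀ a b → (∃ λ k → a ↑ k ≡ b) ⊎ (∃ λ k → b ↑ suc k ≡ a)
level-compare a b with a ℤP.≤? b
... | yes a≤b = inj₁ (∣ a ℤ.- b ∣ , trans (cong (λ c → a ℤ.+ c) (ℤP.∣-∣-≤ a≤b)) (eq a b))
  where
  eq : ∀ a b → a ℤ.+ (b ℤ.- a) ≡ b
  eq = ℤRing.solve-∀
... | no a≰b = gap ∣ b ℤ.- a ∣ (trans (cong (λ c → b ℤ.+ c) (ℤP.∣-∣-≤ (ℤP.<⇒≤ b<a))) (eq b a))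
  where
  eq : ∀ b a → b ℤ.+ (a ℤ.- b) ≡ a
  eq = ℤRing.solve-∀
  b<a : b ℤ.< a
  b<a = ℤP.≰⇒> a≰b
  gap : ∀ k → b ↑ k ≡ a → (∃ λ k → a ↑ k ≡ b) ⊎ (∃ λ k → b ↑ suc k ≡ a)
  gap zero    b≡a = ⊥-elim (ℤP.<-irrefl (trans (sym (↑-identity b)) b≡a) b<a)
  gap (suc k) e   = inj₂ (k , e)

lower-base : ∀ {A : Set} (L : List (ℤ × A)) → ∃ λ a → All (λ x → ∃ λ o → a ↑ o ≡ proj₁ x) L
lower-base []      = 0ℤ , []
lower-base (x ∷ L) with lower-base L
... | a , above with level-compare a (proj₁ x)
...   | inj₁ x-above = a , x-above ∷ above
...   | inj₂ (k , x↑1+k≡a) = proj₁ x , (0 , ↑-identity (proj₁ x)) ∷ All.map (λ {y} → lowered y) above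
  where
  lowered : ∀ y → (∃ λ o → a ↑ o ≡ proj₁ y) → ∃ λ o → proj₁ x ↑ o ≡ proj₁ y
  lowered y (o , a↑o≡y) = suc k + o , trans (sym (↑-↑ (proj₁ x) (suc k) o)) (trans (cong (_↑ o) x↑1+k≡a) a↑o≡y)

strict-base : ∀ {A : Set} (L : List (ℤ × A)) → ∃ λ a → All (λ x → ∃ λ o → a ↑ suc o ≡ proj₁ x) L
strict-base L with lower-base L
... | a , above = a ℤ.- 1ℤ , All.map (λ {y} → shifted y) above
  where
  shifted : ∀ y → (∃ λ o → a ↑ o ≡ proj₁ y) → ∃ λ o → (a ℤ.- 1ℤ) ↑ suc o ≡ proj₁ y
  shifted y (o , a↑o≡y) = o , trans (sym (↑-↑ (a ℤ.- 1ℤ) 1 o)) (trans (cong (_↑ o) (eq a)) a↑o≡y)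
    where
    eq : ∀ a → (a ℤ.- 1ℤ) ℤ.+ 1ℤ ≡ a
    eq = ℤRing.solve-∀

line-step : ∀ a b c → PAdj a b → ∣ a ℤ.- c ∣ ≤ suc ∣ b ℤ.- c ∣
line-step a b c ab = begin
  ∣ a ℤ.- c ∣                   ≡⟨ cong ∣_∣ (eq a b c) ⟩
  ∣ (a ℤ.- b) ℤ.+ (b ℤ.- c) ∣   ≤⟨ ℤP.∣i+j∣≤∣i∣+∣j∣ (a ℤ.- b) (b ℤ.- c) ⟩
  (∣ a ℤ.- b ∣) + ∣ b ℤ.- c ∣   ≡⟨ cong (_+ ∣ b ℤ.- c ∣) ab ⟩
  suc ∣ b ℤ.- c ∣               ∎
  where
  open ≤-Reasoning
  eq : ∀ a b c → a ℤ.- c ≡ (a ℤ.- b) ℤ.+ (b ℤ.- c)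
  eq = ℤRing.solve-∀

private
  upward-walk : ∀ a k → Walk PAdj a (a ↑ k) k
  upward-walk a zero    = subst (λ b → Walk PAdj a b 0) (sym (↑-identity a)) nil
  upward-walk a (suc k) = subst (λ b → Walk PAdj a b (suc k)) (↑-↑ a 1 k)
                            (cons (∣a-a↑k∣ a 1) (upward-walk (a ↑ 1) k))

line-walk : ∀ a b → Walk PAdj a b ∣ a ℤ.- b ∣
line-walk a b with level-compare a b
... | inj₁ (k , refl) = subst (Walk PAdj a (a ↑ k)) (sym (∣a-a↑k∣ a k)) (upward-walk a k)
... | inj₂ (k , refl) = subst (Walk PAdj (b ↑ suc k) b) (sym (∣a↑k-a∣ b (suc k)))
                          (reverseʷ (λ {x} {y} e → trans (ℤP.∣i-j∣≡∣j-i∣ y x) e) (upward-walk b (suc k)))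

level-determined : ∀ a a' → ∣ a ℤ.- 0ℤ ∣ ≡ ∣ a' ℤ.- 0ℤ ∣ → ∣ a ℤ.- 1ℤ ∣ ≡ ∣ a' ℤ.- 1ℤ ∣ → a ≡ a'
level-determined a a' e₀ e₁ = by-cases a a' (trans (sym (∣a-0∣ a)) (trans e₀ (∣a-0∣ a'))) e₁
  where
  ∣a-0∣ : ∀ a → ∣ a ℤ.- 0ℤ ∣ ≡ ∣ a ∣
  ∣a-0∣ a = cong ∣_∣ (ℤP.+-identityʳ a)
  -- 1 + k and -(1 + k) are told apart by their distances k and 2 + k to 1.
  by-cases : ∀ a a' → ∣ a ∣ ≡ ∣ a' ∣ → ∣ a ℤ.- 1ℤ ∣ ≡ ∣ a' ℤ.- 1ℤ ∣ → a ≡ a'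
  by-cases (+ zero)    (+ zero)     _ _ = refl
  by-cases (+ suc k)   (+ suc .k)   refl _ = refl
  by-cases (+ suc k)   -[1+ .k ]    refl e₁ = ⊥-elim (m≢1+n+m k {1} (trans e₁ (cong (λ x → suc (suc x)) (+-identityʳ k))))
  by-cases -[1+ k ]    (+ suc .k)   refl e₁ = ⊥-elim (m≢1+n+m k {1} (trans (sym e₁) (cong (λ x → suc (suc x)) (+-identityʳ k))))
  by-cases -[1+ k ]    -[1+ .k ]    refl _ = refl

-- Two vertices of C_n which are t apart along the labels are at distance
-- tent n t = min(t, n ∸ t).
tent : ℕ → ℕ → ℕ
tent n t = t ⊓ (n ∸ t)

cdist : ℕ → ℕ → ℕ → ℕ
cdist n i j = tent n ∣ i - j ∣

tent-low : ∀ n t → t + t ≤ n → tent n t ≡ t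
tent-low n t t+t≤n = m≤n⇒m⊓n≡m (m+n≤o⇒m≤o∸n t t+t≤n)

tent-high : ∀ n t s → t + s ≡ n → s ≤ t → tent n t ≡ s
tent-high n t s refl s≤t rewrite m+n∸m≡n t s = m≥n⇒m⊓n≡n s≤t

tent-mirror : ∀ n t → t ≤ n → tent n (n ∸ t) ≡ tent n t
tent-mirror n t t≤n rewrite m∸[m∸n]≡n t≤n = ⊓-comm (n ∸ t) t

tent-up : ∀ n t → suc t + suc t ≤ n → tent n (suc t) ≡ suc (tent n t)
tent-up n t le = trans (tent-low n (suc t) le)
                       (cong suc (sym (tent-low n t (≤-trans (+-mono-≤ (n≤1+n t) (n≤1+n t)) le))))

tent-down : ∀ n t s → suc t + s ≡ n → s < t → tent n t ≡ suc (tent n (suc t))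
tent-down n t s e s<t =
  trans (tent-high n t (suc s) (trans (+-suc t s) e) s<t)
        (cong suc (sym (tent-high n (suc t) s e (≤-trans (n≤1+n s) (s≤s (<⇒≤ s<t))))))

tent-rise : ∀ n t → tent n (suc t) ≤ suc (tent n t)
tent-rise n t = ⊓-mono-≤ (≤-refl {suc t}) (≤-trans (∸-monoʳ-≤ n (n≤1+n t)) (n≤1+n (n ∸ t)))

tent-fall : ∀ n t → tent n t ≤ suc (tent n (suc t))
tent-fall n t = ⊓-mono-≤ (m≤n⇒m≤1+n (n≤1+n t))
  (m≤n+o⇒m∸n≤o n t (≤-trans (m≤n+m∸n n (suc t)) (≤-reflexive (sym (+-suc t (n ∸ suc t))))))

cdist-sym : ∀ n i j → cdist n i j ≡ cdist n j i
cdist-sym n i j = cong (tent n) (∣-∣-comm i j)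

cdist-refl : ∀ n i → cdist n i i ≡ 0
cdist-refl n i rewrite ∣n-n∣≡0 i = refl

cdist≡0⇒≡ : ∀ n i j → i < n → j < n → cdist n i j ≡ 0 → i ≡ j
cdist≡0⇒≡ n i j i<n j<n d≡0 with ⊓-sel ∣ i - j ∣ (n ∸ ∣ i - j ∣)
... | inj₁ p = ∣m-n∣≡0⇒m≡n (trans (sym p) d≡0)
... | inj₂ p = ⊥-elim (<⇒≱ diff<n (m∸n≡0⇒m≤n (trans (sym p) d≡0)))
  where
  diff<n : ∣ i - j ∣ < n
  diff<n = ≤-<-trans (∣m-n∣≤m⊔n i j) (⊔-lub i<n j<n)

cdist-wrap : ∀ x y → y ≤ x → cdist (suc x) x y ≡ tent (suc x) (suc y)
cdist-wrap x y y≤x = trans (cong (tent (suc x)) (m≤n⇒∣n-m∣≡n∸m y≤x)) (tent-mirror (suc x) (suc y) (s≤s y≤x))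

-- Rotations of C_n, used to carry facts proved at column 0 to every column.
module Rotation (n : ℕ) where

  rot : ℕ → ℕ
  rot i with suc i <? n
  ... | yes _ = suc i
  ... | no _  = 0

  rot-< : ∀ i → i < n → rot i < n
  rot-< i i<n with suc i <? n
  ... | yes i+1<n = i+1<n
  ... | no _      = ≤-<-trans z≤n i<n

  rot-suc : ∀ i → suc i < n → rot i ≡ suc i
  rot-suc i i+1<n with suc i <? n
  ... | yes _      = refl
  ... | no i+1≮n   = ⊥-elim (i+1≮n i+1<n)

  rot-last : ∀ i → suc i ≡ n → rot i ≡ 0
  rot-last i i+1≡n with suc i <? n
  ... | yes i+1<n = ⊥-elim (<-irrefl i+1≡n i+1<n)
  ... | no _      = refl

  pred<n : 0 < n → n ∸ 1 < n
  pred<n 0<n = ≤-reflexive (m+[n∸m]≡n 0<n)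

  private
    wrap-isometry : ∀ i j → suc i ≡ n → suc j < n → cdist n 0 (suc j) ≡ cdist n i j
    wrap-isometry i j i+1≡n j+1<n =
      sym (subst (λ m → cdist m i j ≡ tent m (suc j)) i+1≡n
                 (cdist-wrap i j (<⇒≤ (≤-pred (≤-trans j+1<n (≤-reflexive (sym i+1≡n)))))))

    last : ∀ i → i < n → ¬ suc i < n → i ≡ n ∸ 1
    last i i<n i+1≮n = cong (_∸ 1) (≤-antisym i<n (≮⇒≥ i+1≮n))

  rot-isometry : ∀ i j → i < n → j < n → cdist n (rot i) (rot j) ≡ cdist n i j
  rot-isometry i j i<n j<n with suc i <? n | suc j <? n
  ... | yes _ | yes _ = refl
  ... | no i+1≮n | no j+1≮n rewrite last i i<n i+1≮n | last j j<n j+1≮n | ∣n-n∣≡0 (n ∸ 1) = refl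
  ... | no i+1≮n | yes j+1<n = wrap-isometry i j (≤-antisym i<n (≮⇒≥ i+1≮n)) j+1<n
  ... | yes i+1<n | no j+1≮n =
    trans (cdist-sym n (suc i) 0) (trans (wrap-isometry j i (≤-antisym j<n (≮⇒≥ j+1≮n)) i+1<n) (cdist-sym n j i))

  rot-onto : ∀ i → i < n → ∃ λ j → j < n × rot j ≡ i
  rot-onto zero    0<n = n ∸ 1 , pred<n 0<n , rot-last (n ∸ 1) (m+[n∸m]≡n 0<n)
  rot-onto (suc i) i+1<n = i , <-trans (n<1+n i) i+1<n , rot-suc i i+1<n

  rotate : ℕ → ℕ → ℕ
  rotate zero    y = y
  rotate (suc b) y = rot (rotate b y)

  rotate-< : ∀ b y → y < n → rotate b y < n
  rotate-< zero    y y<n = y<n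
  rotate-< (suc b) y y<n = rot-< (rotate b y) (rotate-< b y y<n)

  rotate-isometry : ∀ b i j → i < n → j < n → cdist n (rotate b i) (rotate b j) ≡ cdist n i j
  rotate-isometry zero    i j i<n j<n = refl
  rotate-isometry (suc b) i j i<n j<n =
    trans (rot-isometry (rotate b i) (rotate b j) (rotate-< b i i<n) (rotate-< b j j<n)) (rotate-isometry b i j i<n j<n)

  rotate-zero : ∀ b → b < n → rotate b 0 ≡ b
  rotate-zero zero    b<n = refl
  rotate-zero (suc b) b+1<n = trans (cong rot (rotate-zero b (<-trans (n<1+n b) b+1<n))) (rot-suc b b+1<n)

  rotate-rot : ∀ b y → rotate b (rot y) ≡ rot (rotate b y)
  rotate-rot zero    y = refl
  rotate-rot (suc b) y = cong rot (rotate-rot b y)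

  rotate-one : 1 < n → ∀ c → c < n → rotate c 1 ≡ rot c
  rotate-one 1<n c c<n = trans (cong (rotate c) (sym (rot-suc 0 1<n))) (trans (rotate-rot c 0) (cong rot (rotate-zero c c<n)))

  rotate-onto : ∀ b i → i < n → ∃ λ j → j < n × rotate b j ≡ i
  rotate-onto zero    i i<n = i , i<n , refl
  rotate-onto (suc b) i i<n with rot-onto i i<n
  ... | k , k<n , rot-k≡i with rotate-onto b k k<n
  ...   | j , j<n , rotate-j≡k = j , j<n , trans (cong rot rotate-j≡k) rot-k≡i

  -- C_n is vertex-transitive: a relation between the distances from y to
  -- column 0 and to its neighbours 1 and n ∸ 1, valid for every y, holds at
  -- every column c with its neighbours rotate c 1 and rotate c (n ∸ 1).
  transport : (R : ℕ → ℕ → ℕ → Set) →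
              (∀ y → y < n → R (cdist n 0 y) (cdist n 1 y) (cdist n (n ∸ 1) y)) →
              1 < n → ∀ c y → c < n → y < n →
              R (cdist n c y) (cdist n (rotate c 1) y) (cdist n (rotate c (n ∸ 1)) y)
  transport R at-0 1<n c y c<n y<n with rotate-onto c y y<n
  ... | y₀ , y₀<n , refl =
    subst₂ (λ d d₊ → R d d₊ (cdist n (rotate c (n ∸ 1)) (rotate c y₀)))
           (sym (trans (cong (λ b → cdist n b (rotate c y₀)) (sym (rotate-zero c c<n))) (moved 0 0<n)))
           (sym (moved 1 1<n))
           (subst (R (cdist n 0 y₀) (cdist n 1 y₀)) (sym (moved (n ∸ 1) (pred<n 0<n))) (at-0 y₀ y₀<n))
    where
    0<n : 0 < n
    0<n = <-trans (s≤s z≤n) 1<n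
    moved : ∀ i → i < n → cdist n (rotate c i) (rotate c y₀) ≡ cdist n i y₀
    moved i i<n = rotate-isometry c i y₀ i<n y₀<n

≤-by : ∀ {a b} c → a + c ≡ b → a ≤ b
≤-by {a} c refl = m≤m+n a c

lipschitz-at-0 : ∀ n y → cdist n 0 y ≤ suc (cdist n 1 y) × cdist n 1 y ≤ suc (cdist n 0 y)
lipschitz-at-0 n zero    = z≤n , m⊓n≤m 1 (n ∸ 1)
lipschitz-at-0 n (suc s) = tent-rise n s , tent-fall n s

cdist-last-0 : ∀ m → 1 ≤ m → cdist (suc m) m 0 ≡ 1
cdist-last-0 m 1≤m = begin
  tent (suc m) ∣ m - 0 ∣ ≡⟨ cong (tent (suc m)) (∣-∣-identityʳ m) ⟩
  tent (suc m) m         ≡⟨ tent-mirror (suc m) 1 (s≤s z≤n) ⟩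
  tent (suc m) 1         ≡⟨ tent-low (suc m) 1 (s≤s 1≤m) ⟩
  1                      ∎
  where open ≡-Reasoning

toward-at-0 : ∀ m y → y < suc m → cdist (suc m) 0 y ≢ 0 →
              (cdist (suc m) 0 y ≡ suc (cdist (suc m) 1 y)) ⊎ (cdist (suc m) 0 y ≡ suc (cdist (suc m) m y))
toward-at-0 m zero    _         d≢0 = ⊥-elim (d≢0 refl)
toward-at-0 m (suc s) (s≤s s<m) _   with suc s + suc s ≤? suc m | m≤n⇒∃[o]m+o≡n s<m
... | yes left  | _     = inj₁ (tent-up (suc m) s left)
... | no  right | r , e =
  inj₂ (trans (tent-down (suc m) (suc s) r (cong suc e) r<s+1) (cong suc (sym (cdist-wrap m (suc s) s<m))))
  where
  r<s+1 : r < suc s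
  r<s+1 = +-cancelˡ-< (suc s) r (suc s) (<-trans (n<1+n (suc s + r)) (subst (_< suc s + suc s) (sym (cong suc e)) (≰⇒> right)))

-- The distances d, d₁, d₂ from a vertex to a column and to its two
-- neighbours in the even cycle C_{H+H}: at the column itself both neighbours
-- are farther, at the antipode both are nearer, and on the two slopes in
-- between one neighbour is nearer and the other farther.
data EvenProfile (H d d₁ d₂ : ℕ) : Set where
  centre   : d ≡ 0 → d₁ ≡ suc d → d₂ ≡ suc d → EvenProfile H d d₁ d₂
  slope₁   : d < H → d ≡ suc d₁ → d₂ ≡ suc d → EvenProfile H d d₁ d₂
  slope₂   : d < H → d₁ ≡ suc d → d ≡ suc d₂ → EvenProfile H d d₁ d₂
  antipode : d ≡ H → d ≡ suc d₁ → d ≡ suc d₂ → EvenProfile H d d₁ d₂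

half-gap : ∀ h k r → suc (suc (suc h + k)) + r ≡ suc h + suc h → suc (k + r) ≡ h
half-gap h k r e = suc-injective (+-cancelˡ-≡ (suc h) _ _ (trans (sym (eq h k r)) e))
  where
  eq : ∀ h k r → suc (suc (suc h + k)) + r ≡ suc h + suc (suc (k + r))
  eq = ℕRing.solve-∀

private
  TentProfile : ℕ → ℕ → Set
  TentProfile h s = EvenProfile (suc h) (tent n (suc s)) (tent n s) (tent n (suc (suc s)))
    where
    n : ℕ
    n = suc h + suc h

  tent-profile-far : ∀ k r → TentProfile (suc (k + r)) (suc (suc (k + r)) + k)
  tent-profile-far k r =
    slope₂ (subst (_< H) (sym (tent-high n (suc s) (suc r) e₂ (≤-by (suc (suc (k + k))) (eq₃ k r))))
                  (s≤s (s≤s (m≤n+m r k))))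
           (tent-down n s (suc r) e₂ (≤-by (k + k) (eq₄ k r)))
           (tent-down n (suc s) r e₁ (≤-by (suc (suc (k + k))) (eq₃ k r)))
    where
    H : ℕ
    H = suc (suc (k + r))
    n : ℕ
    n = H + H
    s : ℕ
    s = H + k
    eq₁ : ∀ k r → suc (suc (suc (suc (k + r)) + k)) + r ≡ suc (suc (k + r)) + suc (suc (k + r))
    eq₁ = ℕRing.solve-∀
    e₁ : suc (suc s) + r ≡ n
    e₁ = eq₁ k r
    e₂ : suc s + suc r ≡ n
    e₂ = trans (+-suc (suc s) r) e₁
    eq₃ : ∀ k r → suc r + suc (suc (k + k)) ≡ suc (suc (suc (k + r)) + k)
    eq₃ = ℕRing.solve-∀
    eq₄ : ∀ k r → suc (suc r) + (k + k) ≡ suc (suc (k + r)) + k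
    eq₄ = ℕRing.solve-∀

  even-tent-profile : ∀ h s → suc s < suc h + suc h → TentProfile h s
  even-tent-profile h s s+1<n with compare (suc s) (suc h)
  ... | less .(suc s) k =
    slope₁ (subst (_< suc h) (sym (tent-low n (suc s) left₁)) (s≤s (s≤s (m≤m+n s k))))
           (tent-up n s left₁) (tent-up n (suc s) left₂)
    where
    n : ℕ
    n = suc h + suc h
    left₂ : suc (suc s) + suc (suc s) ≤ n
    left₂ = ≤-by (k + k) (eq s k)
      where
      eq : ∀ s k → suc (suc s) + suc (suc s) + (k + k) ≡ suc (suc s + k) + suc (suc s + k)
      eq = ℕRing.solve-∀
    left₁ : suc s + suc s ≤ n
    left₁ = ≤-trans (+-mono-≤ (n≤1+n (suc s)) (n≤1+n (suc s))) left₂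
  ... | equal .(suc s) =
    antipode (tent-low n (suc s) ≤-refl) (tent-up n s ≤-refl)
             (tent-down n (suc s) s (cong suc (sym (+-suc s s))) (n<1+n s))
    where
    n : ℕ
    n = suc s + suc s
  ... | greater .(suc h) k with m≤n⇒∃[o]m+o≡n s+1<n
  ...   | r , e rewrite sym (half-gap h k r e) = tent-profile-far k r

even-profile-at-0 : ∀ h y → y < suc h + suc h →
  EvenProfile (suc h) (cdist (suc h + suc h) 0 y) (cdist (suc h + suc h) 1 y) (cdist (suc h + suc h) (h + suc h) y)
even-profile-at-0 h zero    _ = centre refl (tent-low (suc h + suc h) 1 (s≤s 1≤m)) (cdist-last-0 (h + suc h) 1≤m)
  where
  1≤m : 1 ≤ h + suc h
  1≤m = ≤-trans (s≤s z≤n) (m≤n+m (suc h) h)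
even-profile-at-0 h (suc s) s+1<n =
  subst (EvenProfile (suc h) (tent n (suc s)) (tent n s)) (sym (cdist-wrap (h + suc h) (suc s) (≤-pred s+1<n)))
        (even-tent-profile h s s+1<n)
  where
  n : ℕ
  n = suc h + suc h

module Grid (m : ℕ) (2≤m : 2 ≤ m) where

  n : ℕ
  n = suc m

  open Rotation n using (rot; rotate-one)

  1<n : 1 < n
  1<n = s≤s (≤-trans (s≤s z≤n) 2≤m)

  cd : Fin n → Fin n → ℕ
  cd i j = cdist n (toℕ i) (toℕ j)

  next prev : Fin n → Fin n
  next c = fromℕ< (Rotation.rotate-< n (toℕ c) 1 1<n)
  prev c = fromℕ< (Rotation.rotate-< n (toℕ c) m (≤-refl {n}))

  next-toℕ : ∀ c → toℕ (next c) ≡ Rotation.rotate n (toℕ c) 1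
  next-toℕ c = toℕ-fromℕ< (Rotation.rotate-< n (toℕ c) 1 1<n)

  prev-toℕ : ∀ c → toℕ (prev c) ≡ Rotation.rotate n (toℕ c) m
  prev-toℕ c = toℕ-fromℕ< (Rotation.rotate-< n (toℕ c) m (≤-refl {n}))

  at-every-column : (R : ℕ → ℕ → ℕ → Set) → (∀ y → y < n → R (cdist n 0 y) (cdist n 1 y) (cdist n m y)) →
                    ∀ c y → R (cd c y) (cd (next c) y) (cd (prev c) y)
  at-every-column R at-0 c y
    rewrite next-toℕ c | prev-toℕ c =
    Rotation.transport n R at-0 1<n (toℕ c) (toℕ y) (toℕ<n c) (toℕ<n y)

  neighbours-adjacent : ∀ c → cd (next c) c ≡ 1 × cd (prev c) c ≡ 1
  neighbours-adjacent c = at-every-column (λ d d₁ d₂ → d ≡ 0 → d₁ ≡ 1 × d₂ ≡ 1) at-0 c c (cdist-refl n (toℕ c))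
    where
    at-0 : ∀ y → y < n → cdist n 0 y ≡ 0 → cdist n 1 y ≡ 1 × cdist n m y ≡ 1
    at-0 y y<n d≡0 rewrite sym (cdist≡0⇒≡ n 0 y (s≤s z≤n) y<n d≡0) =
      tent-low n 1 1<n , cdist-last-0 m (≤-trans (s≤s z≤n) 2≤m)

  next≢prev : ∀ c → next c ≢ prev c
  next≢prev c next≡prev = <-irrefl 1≡m 2≤m
    where
    open Rotation n
    1≡m : 1 ≡ m
    1≡m = cdist≡0⇒≡ n 1 m 1<n ≤-refl (begin
      cdist n 1 m                                 ≡⟨ sym (rotate-isometry (toℕ c) 1 m 1<n ≤-refl) ⟩
      cdist n (rotate (toℕ c) 1) (rotate (toℕ c) m) ≡⟨ cong₂ (cdist n) (sym (next-toℕ c)) (sym (prev-toℕ c)) ⟩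
      cd (next c) (prev c)                        ≡⟨ cong (cd (next c)) (sym next≡prev) ⟩
      cd (next c) (next c)                        ≡⟨ cdist-refl n (toℕ (next c)) ⟩
      0                                           ∎)
      where open ≡-Reasoning

  Neighbour : Fin n → Fin n → Set
  Neighbour c p = (p ≡ next c) ⊎ (p ≡ prev c)

  neighbour-adjacent : ∀ c p → Neighbour c p → cd p c ≡ 1
  neighbour-adjacent c .(next c) (inj₁ refl) = proj₁ (neighbours-adjacent c)
  neighbour-adjacent c .(prev c) (inj₂ refl) = proj₂ (neighbours-adjacent c)

  neighbours-equidistant : ∀ c → cd (next c) c ≡ cd (prev c) c
  neighbours-equidistant c = trans (proj₁ (neighbours-adjacent c)) (sym (proj₂ (neighbours-adjacent c)))

  toward : ∀ c x → x ≢ c → (cd c x ≡ suc (cd (next c) x)) ⊎ (cd c x ≡ suc (cd (prev c) x))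
  toward c x x≢c = at-every-column (λ d d₁ d₂ → d ≢ 0 → (d ≡ suc d₁) ⊎ (d ≡ suc d₂)) (toward-at-0 m) c x
                     (λ d≡0 → x≢c (toℕ-injective (sym (cdist≡0⇒≡ n (toℕ c) (toℕ x) (toℕ<n c) (toℕ<n x) d≡0))))

  lipschitz : ∀ c y → cd c y ≤ suc (cd (next c) y) × cd (next c) y ≤ suc (cd c y)
  lipschitz = at-every-column (λ d d₁ _ → d ≤ suc d₁ × d₁ ≤ suc d) (λ y _ → lipschitz-at-0 n y)

  next-is-rot : ∀ c → toℕ (next c) ≡ rot (toℕ c)
  next-is-rot c = trans (next-toℕ c) (rotate-one 1<n (toℕ c) (toℕ<n c))

  edge-next : ∀ v w → CAdj n v w → (w ≡ next v) ⊎ (v ≡ next w)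
  edge-next v w (inj₁ vw) = ordered v w vw
    where
    ordered : ∀ v w → COrdAdj n v w → (w ≡ next v) ⊎ (v ≡ next w)
    ordered v w (v≤w , inj₁ gap≡1) = inj₁ (toℕ-injective (trans w≡1+v (sym (trans (next-is-rot v) (Rotation.rot-suc n (toℕ v) 1+v<n)))))
      where
      w≡1+v : toℕ w ≡ suc (toℕ v)
      w≡1+v = trans (sym (m+[n∸m]≡n v≤w)) (trans (cong (λ g → toℕ v + g) gap≡1) (+-comm (toℕ v) 1))
      1+v<n : suc (toℕ v) < n
      1+v<n = subst (_< n) w≡1+v (toℕ<n w)
    ordered v w (v≤w , inj₂ gap≡m) = inj₂ (toℕ-injective (trans v≡0 (sym (trans (next-is-rot w) (Rotation.rot-last n (toℕ w) (cong suc w≡m))))))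
      where
      w≡m : toℕ w ≡ m
      w≡m = ≤-antisym (≤-pred (toℕ<n w)) (≤-trans (≤-reflexive (sym gap≡m)) (m∸n≤m (toℕ w) (toℕ v)))
      v≡0 : toℕ v ≡ 0
      v≡0 = begin
        toℕ v                         ≡⟨ sym (m∸[m∸n]≡n v≤w) ⟩
        toℕ w ∸ (toℕ w ∸ toℕ v)       ≡⟨ cong₂ _∸_ w≡m gap≡m ⟩
        m ∸ m                         ≡⟨ n∸n≡0 m ⟩
        0                             ∎
        where open ≡-Reasoning
  edge-next v w (inj₂ wv) with edge-next w v (inj₁ wv)
  ... | inj₁ v≡next-w = inj₂ v≡next-w
  ... | inj₂ w≡next-v = inj₁ w≡next-v

  cd-step : ∀ v w y → CAdj n v w → cd v y ≤ suc (cd w y)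
  cd-step v w y vw with edge-next v w vw
  ... | inj₁ refl = proj₁ (lipschitz v y)
  ... | inj₂ refl = proj₂ (lipschitz w y)

  private
    CAdj-sym : ∀ {v w} → CAdj n v w → CAdj n w v
    CAdj-sym (inj₁ vw) = inj₂ vw
    CAdj-sym (inj₂ wv) = inj₁ wv

    gap : ∀ {i j t} → i + t ≡ j → ∣ i - j ∣ ≡ t
    gap {i} {t = t} refl = ∣m-m+n∣≡n i t

    climb : ∀ k (i j : Fin n) → toℕ i + k ≡ toℕ j → Walk (CAdj n) i j k
    climb zero    i j e = subst (λ j → Walk (CAdj n) i j 0) (toℕ-injective (trans (sym (+-identityʳ (toℕ i))) e)) nil
    climb (suc k) i j e = cons step (climb k i' j (trans (cong (_+ k) (toℕ-fromℕ< 1+i<n)) (trans (sym (+-suc (toℕ i) k)) e)))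
      where
      1+i<n : suc (toℕ i) < n
      1+i<n = ≤-<-trans (≤-trans (m≤m+n (suc (toℕ i)) k) (≤-reflexive (trans (sym (+-suc (toℕ i) k)) e))) (toℕ<n j)
      i' : Fin n
      i' = fromℕ< 1+i<n
      step : CAdj n i i'
      step = inj₁ (subst (λ x → toℕ i ≤ x) (sym (toℕ-fromℕ< 1+i<n)) (n≤1+n (toℕ i)) ,
                   inj₁ (trans (cong (_∸ toℕ i) (toℕ-fromℕ< 1+i<n)) (trans (+-∸-assoc 1 (≤-refl {toℕ i})) (cong suc (n∸n≡0 (toℕ i))))))

    -- A shortest walk from i up to j: straight up, or down through 0 and around.
    walk-up : ∀ i j → toℕ i ≤ toℕ j → Walk (CAdj n) i j (cd i j)
    walk-up i j i≤j with m≤n⇒∃[o]m+o≡n i≤j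
    ... | t , i+t≡j with t + t ≤? n
    ...   | yes short = subst (Walk (CAdj n) i j) (sym (trans (cong (tent n) (gap i+t≡j)) (tent-low n t short))) (climb t i j i+t≡j)
    ...   | no long with m≤n⇒∃[o]m+o≡n (≤-pred (toℕ<n j))
    ...     | r , j+r≡m = subst (Walk (CAdj n) i j) (sym dist)
                            (reverseʷ CAdj-sym (climb (toℕ i) Fin.zero i refl)
                             ++ʷ cons wrap (reverseʷ CAdj-sym (climb r j (fromℕ m) (trans j+r≡m (sym (toℕ-fromℕ m))))))
      where
      wrap : CAdj n Fin.zero (fromℕ m)
      wrap = inj₁ (z≤n , inj₂ (toℕ-fromℕ m))
      around : t + (toℕ i + suc r) ≡ n
      around = trans (eq t (toℕ i) r) (cong suc (trans (cong (_+ r) i+t≡j) j+r≡m))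
        where
        eq : ∀ t i r → t + (i + suc r) ≡ suc (i + t + r)
        eq = ℕRing.solve-∀
      dist : cd i j ≡ toℕ i + suc r
      dist = trans (cong (tent n) (gap i+t≡j))
                   (tent-high n t (toℕ i + suc r) around (<⇒≤ (+-cancelˡ-< t _ t (subst (_< t + t) (sym around) (≰⇒> long)))))

  cd-walk : ∀ i j → Walk (CAdj n) i j (cd i j)
  cd-walk i j with ≤-total (toℕ i) (toℕ j)
  ... | inj₁ i≤j = walk-up i j i≤j
  ... | inj₂ j≤i = subst (Walk (CAdj n) i j) (cdist-sym n (toℕ j) (toℕ i)) (reverseʷ CAdj-sym (walk-up j i j≤i))

  D : PCV n → PCV n → ℕ
  D (a , i) (b , j) = ∣ a ℤ.- b ∣ + cd i j

  D-refl : ∀ u → D u u ≡ 0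
  D-refl (a , i) rewrite ∣a-a∣≡0 a = cdist-refl n (toℕ i)

  D-step : ∀ u w v → PCAdj n u w → D u v ≤ suc (D w v)
  D-step (a , i) (.a , j) (c , k) (inj₁ (refl , ij)) =
    ≤-trans (+-monoʳ-≤ ∣ a ℤ.- c ∣ (cd-step i j k ij)) (≤-reflexive (+-suc ∣ a ℤ.- c ∣ (cd j k)))
  D-step (a , i) (b , .i) (c , k) (inj₂ (refl , ab)) = +-monoˡ-≤ (cd i k) (line-step a b c ab)

  D-walk : ∀ u v → Walk (PCAdj n) u v (D u v)
  D-walk (a , i) (b , j) = lift-levels (line-walk a b) ++ʷ lift-columns (cd-walk i j)
    where
    lift-levels : ∀ {a b k} → Walk PAdj a b k → Walk (PCAdj n) (a , i) (b , i) k
    lift-levels nil        = nil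
    lift-levels (cons e p) = cons (inj₂ (refl , e)) (lift-levels p)
    lift-columns : ∀ {i j k} → Walk (CAdj n) i j k → Walk (PCAdj n) (b , i) (b , j) k
    lift-columns nil        = nil
    lift-columns (cons e p) = cons (inj₁ (refl , e)) (lift-columns p)

  seen-from : ∀ a i a' i' b {w} c → toℕ w ≡ c → D (a , i) (b , w) ≡ D (a' , i') (b , w) →
              ∣ a ℤ.- b ∣ + cdist n c (toℕ i) ≡ ∣ a' ℤ.- b ∣ + cdist n c (toℕ i')
  seen-from a i a' i' b .(toℕ _) refl e =
    trans (cong (λ d → ∣ a ℤ.- b ∣ + d) (cdist-sym n _ (toℕ i))) (trans e (cong (λ d → ∣ a' ℤ.- b ∣ + d) (cdist-sym n (toℕ i') _)))

  level-and-column : ∀ a i a' i' {z} → toℕ z ≡ 0 → ∣ a ℤ.- 0ℤ ∣ ≡ ∣ a' ℤ.- 0ℤ ∣ → toℕ i ≡ toℕ i' →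
                     D (a , i) (1ℤ , z) ≡ D (a' , i') (1ℤ , z) → (a , i) ≡ (a' , i')
  level-and-column a i a' i' z≡0 A≡A' i≡i' e = cong₂ _,_ (level-determined a a' A≡A' A₁≡A₁') (toℕ-injective i≡i')
    where
    A₁≡A₁' : ∣ a ℤ.- 1ℤ ∣ ≡ ∣ a' ℤ.- 1ℤ ∣
    A₁≡A₁' = +-cancelʳ-≡ _ _ _ (trans (seen-from a i a' i' 1ℤ 0 z≡0 e) (cong (λ d → ∣ a' ℤ.- 1ℤ ∣ + cdist n 0 d) (sym i≡i')))

  levels-differ : ∀ {a b} {v w : Fin n} → a ≢ b → _≢_ {A = PCV n} (a , v) (b , w)
  levels-differ a≢b e = a≢b (cong proj₁ e)

  columns-differ : ∀ {a} {v w : Fin n} {x y} → toℕ v ≡ x → toℕ w ≡ y → x ≢ y → _≢_ {A = PCV n} (a , v) (a , w)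
  columns-differ v≡x w≡y x≢y e = x≢y (trans (sym v≡x) (trans (cong (λ u → toℕ (proj₂ u)) e) w≡y))

  open DistanceFunction (PCAdj n) D D-refl D-step D-walk public

∣1+t-o∣ : ∀ t o → o ≤ t → ∣ suc t - o ∣ ≡ suc ∣ t - o ∣
∣1+t-o∣ t o o≤t = begin
  ∣ suc t - o ∣   ≡⟨ m≤n⇒∣n-m∣≡n∸m (m≤n⇒m≤1+n o≤t) ⟩
  suc t ∸ o       ≡⟨ +-∸-assoc 1 o≤t ⟩
  suc (t ∸ o)     ≡⟨ cong suc (sym (m≤n⇒∣n-m∣≡n∸m o≤t)) ⟩
  suc ∣ t - o ∣   ∎
  where open ≡-Reasoning

∣t-o∣ : ∀ t o → t < o → ∣ t - o ∣ ≡ suc ∣ suc t - o ∣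
∣t-o∣ t (suc o) (s≤s t≤o) = trans (∣-∣-comm t (suc o)) (trans (∣1+t-o∣ o t t≤o) (cong suc (∣-∣-comm o t)))

module Confusion (m : ℕ) (2≤m : 2 ≤ m) where
  open Grid m 2≤m

  Nearer : Fin n → Fin n → Fin n → Set
  Nearer p q y = cd q y ≡ suc (cd p y)

  place : ℤ → ℕ × Fin n → PCV n
  place a (o , w) = a ↑ o , w

  nearer-self : ∀ c p → Neighbour c p → Nearer c p c
  nearer-self c p p~c = trans (neighbour-adjacent c p p~c) (cong suc (sym (cdist-refl n (toℕ c))))

  CutSide : ℕ → Fin n → Fin n → ℕ × Fin n → Set
  CutSide t p q (o , w) = (o ≤ t × Nearer p q w) ⊎ (t < o × Nearer q p w)

  -- Such landmarks do not distinguish (a ↑ t , q) from (a ↑ suc t , p):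
  -- what one of them gains in level the other gains in column.
  cut : ∀ a t p q Ls → All (CutSide t p q) Ls → Confused (map (place a) Ls)
  cut a t p q Ls sides = (a ↑ t , q) , (a ↑ suc t , p) , levels-differ t≢1+t , map⁺ (All.map twin sides)
    where
    t≢1+t : a ↑ t ≢ a ↑ suc t
    t≢1+t e = 1+n≢n (sym (↑-injective a t (suc t) e))
    twin : ∀ {x} → CutSide t p q x → D (a ↑ t , q) (place a x) ≡ D (a ↑ suc t , p) (place a x)
    twin {o , w} (inj₁ (o≤t , near-p)) = begin
      (∣ a ↑ t ℤ.- a ↑ o ∣) + cd q w       ≡⟨ cong₂ _+_ (∣a↑i-a↑j∣ a t o) near-p ⟩
      (∣ t - o ∣) + suc (cd p w)           ≡⟨ +-suc (∣ t - o ∣) (cd p w) ⟩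
      suc (∣ t - o ∣) + cd p w             ≡⟨ cong (_+ cd p w) (sym (∣1+t-o∣ t o o≤t)) ⟩
      (∣ suc t - o ∣) + cd p w             ≡⟨ cong (_+ cd p w) (sym (∣a↑i-a↑j∣ a (suc t) o)) ⟩
      (∣ a ↑ suc t ℤ.- a ↑ o ∣) + cd p w   ∎
      where open ≡-Reasoning
    twin {o , w} (inj₂ (t<o , near-q)) = begin
      (∣ a ↑ t ℤ.- a ↑ o ∣) + cd q w       ≡⟨ cong (_+ cd q w) (trans (∣a↑i-a↑j∣ a t o) (∣t-o∣ t o t<o)) ⟩
      suc (∣ suc t - o ∣) + cd q w         ≡⟨ sym (+-suc (∣ suc t - o ∣) (cd q w)) ⟩
      (∣ suc t - o ∣) + suc (cd q w)       ≡⟨ cong₂ _+_ (sym (∣a↑i-a↑j∣ a (suc t) o)) (sym near-q) ⟩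
      (∣ a ↑ suc t ℤ.- a ↑ o ∣) + cd p w   ∎
      where open ≡-Reasoning

  SandwichSide : ℕ → Fin n → Fin n → ℕ × Fin n → Set
  SandwichSide t p q (o , w) =
    (o ≡ suc t × cd p w ≡ cd q w) ⊎ (suc t < o × cd p w ≡ 2 + cd q w) ⊎ (o ≤ t × cd q w ≡ 2 + cd p w)

  sandwich : ∀ a t p q Ls → All (SandwichSide t p q) Ls → Confused (map (place a) Ls)
  sandwich a t p q Ls sides = (a ↑ t , q) , (a ↑ suc (suc t) , p) , levels-differ t≢2+t , map⁺ (All.map twin sides)
    where
    t≢2+t : a ↑ t ≢ a ↑ suc (suc t)
    t≢2+t e = m≢1+m+n t (trans (↑-injective a t (suc (suc t)) e) (cong suc (sym (+-comm t 1))))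
    twin : ∀ {x} → SandwichSide t p q x → D (a ↑ t , q) (place a x) ≡ D (a ↑ suc (suc t) , p) (place a x)
    twin {.(suc t) , w} (inj₁ (refl , same)) = begin
      (∣ a ↑ t ℤ.- a ↑ suc t ∣) + cd q w                ≡⟨ cong₂ _+_ (trans (∣a↑i-a↑j∣ a t (suc t)) (∣-∣-comm t (suc t))) (sym same) ⟩
      (∣ suc t - t ∣) + cd p w                          ≡⟨ cong (_+ cd p w) (sym (∣a↑i-a↑j∣ a (suc (suc t)) (suc t))) ⟩
      (∣ a ↑ suc (suc t) ℤ.- a ↑ suc t ∣) + cd p w      ∎
      where open ≡-Reasoning
    twin {o , w} (inj₂ (inj₁ (1+t<o , far-from-p))) = begin
      (∣ a ↑ t ℤ.- a ↑ o ∣) + cd q w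
        ≡⟨ cong (_+ cd q w) (trans (∣a↑i-a↑j∣ a t o) (trans (∣t-o∣ t o (<-trans (n<1+n t) 1+t<o)) (cong suc (∣t-o∣ (suc t) o 1+t<o)))) ⟩
      suc (suc g) + cd q w
        ≡⟨ sym (trans (+-suc g (suc (cd q w))) (cong suc (+-suc g (cd q w)))) ⟩
      g + suc (suc (cd q w))
        ≡⟨ cong₂ _+_ (sym (∣a↑i-a↑j∣ a (suc (suc t)) o)) (sym far-from-p) ⟩
      (∣ a ↑ suc (suc t) ℤ.- a ↑ o ∣) + cd p w ∎
      where
      open ≡-Reasoning
      g : ℕ
      g = ∣ suc (suc t) - o ∣
    twin {o , w} (inj₂ (inj₂ (o≤t , far-from-q))) = begin
      (∣ a ↑ t ℤ.- a ↑ o ∣) + cd q w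
        ≡⟨ cong₂ _+_ (∣a↑i-a↑j∣ a t o) far-from-q ⟩
      g + suc (suc (cd p w))
        ≡⟨ trans (+-suc g (suc (cd p w))) (cong suc (+-suc g (cd p w))) ⟩
      suc (suc g) + cd p w
        ≡⟨ cong (_+ cd p w) (sym (trans (∣1+t-o∣ (suc t) o (m≤n⇒m≤1+n o≤t)) (cong suc (∣1+t-o∣ t o o≤t)))) ⟩
      (∣ suc (suc t) - o ∣) + cd p w
        ≡⟨ cong (_+ cd p w) (sym (∣a↑i-a↑j∣ a (suc (suc t)) o)) ⟩
      (∣ a ↑ suc (suc t) ℤ.- a ↑ o ∣) + cd p w ∎
      where
      open ≡-Reasoning
      g : ℕ
      g = ∣ t - o ∣

  equidistant : ∀ p q → p ≢ q → ∀ L → All (λ x → cd p (proj₂ x) ≡ cd q (proj₂ x)) L → Confused L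
  equidistant p q p≢q L same = (0ℤ , p) , (0ℤ , q) , (λ e → p≢q (cong proj₂ e)) , All.map (λ {x} → twin x) same
    where
    twin : ∀ x → cd p (proj₂ x) ≡ cd q (proj₂ x) → D (0ℤ , p) x ≡ D (0ℤ , q) x
    twin (b , w) e = cong (λ d → (∣ 0ℤ ℤ.- b ∣) + d) e

  around : ∀ c L → All (λ x → cd (next c) (proj₂ x) ≡ cd (prev c) (proj₂ x)) L → Confused L
  around c = equidistant (next c) (prev c) (next≢prev c)

  private
    ordered-pair-confused : ∀ a o₁ o₂ c₁ c₂ → o₁ ≤ o₂ → Confused ((a ↑ suc o₁ , c₁) ∷ (a ↑ suc o₂ , c₂) ∷ [])
    ordered-pair-confused a o₁ o₂ c₁ c₂ o₁≤o₂ with m≤n⇒m<n∨m≡n o₁≤o₂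
    ... | inj₂ refl = sandwich a o₁ c₁ c₁ ((suc o₁ , c₁) ∷ (suc o₁ , c₂) ∷ [])
                        (inj₁ (refl , refl) ∷ inj₁ (refl , refl) ∷ [])
    ... | inj₁ o₁<o₂ with c₂ Fin.≟ c₁
    ...   | yes refl = around c₁ _ (neighbours-equidistant c₁ ∷ neighbours-equidistant c₁ ∷ [])
    ...   | no c₂≢c₁ with toward c₁ c₂ c₂≢c₁
    ...     | inj₁ nearer-next = cut a (suc o₁) c₁ (next c₁) ((suc o₁ , c₁) ∷ (suc o₂ , c₂) ∷ [])
                                   ( inj₁ (≤-refl , nearer-self c₁ (next c₁) (inj₁ refl))
                                   ∷ inj₂ (s≤s o₁<o₂ , nearer-next) ∷ [])
    ...     | inj₂ nearer-prev = cut a (suc o₁) c₁ (prev c₁) ((suc o₁ , c₁) ∷ (suc o₂ , c₂) ∷ [])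
                                   ( inj₁ (≤-refl , nearer-self c₁ (prev c₁) (inj₂ refl))
                                   ∷ inj₂ (s≤s o₁<o₂ , nearer-prev) ∷ [])

  pair-confused : ∀ x y → Confused (x ∷ y ∷ [])
  pair-confused (b₁ , c₁) (b₂ , c₂) with strict-base ((b₁ , c₁) ∷ (b₂ , c₂) ∷ [])
  ... | a , (o₁ , refl) ∷ (o₂ , refl) ∷ [] with ≤-total o₁ o₂
  ...   | inj₁ o₁≤o₂ = ordered-pair-confused a o₁ o₂ c₁ c₂ o₁≤o₂
  ...   | inj₂ o₂≤o₁ = confused-↭ (↭-swap _ _ ↭-refl) (ordered-pair-confused a o₂ o₁ c₂ c₁ o₂≤o₁)

-- For even n = 2H no three landmarks resolve the grid: the bipartite cycle
-- C_{2H} always offers an edge separating the landmarks by level, unless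
-- antipodal columns allow a sandwich or two equidistant columns.
module EvenConfusion (h : ℕ) (1≤h : 1 ≤ h) where

  private
    2≤m : 2 ≤ h + suc h
    2≤m = ≤-trans (s≤s 1≤h) (m≤n+m (suc h) h)

  open Grid (h + suc h) 2≤m
  open Confusion (h + suc h) 2≤m

  H : ℕ
  H = suc h

  profile : ∀ c y → EvenProfile H (cd c y) (cd (next c) y) (cd (prev c) y)
  profile = at-every-column (EvenProfile H) (even-profile-at-0 h)

  bipartite : ∀ c p → Neighbour c p → ∀ y → Nearer c p y ⊎ Nearer p c y
  bipartite c .(next c) (inj₁ refl) y with profile c y
  ... | centre _ farther _   = inj₁ farther
  ... | slope₁ _ nearer _    = inj₂ nearer
  ... | slope₂ _ farther _   = inj₁ farther
  ... | antipode _ nearer _  = inj₂ nearer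
  bipartite c .(prev c) (inj₂ refl) y with profile c y
  ... | centre _ _ farther   = inj₁ farther
  ... | slope₁ _ _ farther   = inj₁ farther
  ... | slope₂ _ _ nearer    = inj₂ nearer
  ... | antipode _ _ nearer  = inj₂ nearer

  record Away (c y : Fin n) : Set where
    field
      far          : Fin n
      is-neighbour : Neighbour c far
      farther      : Nearer c far y

  away-or-antipode : ∀ c y → Away c y ⊎ (cd c y ≡ H × cd (next c) y ≡ cd (prev c) y)
  away-or-antipode c y with profile c y
  ... | centre _ farther _       = inj₁ (record { far = next c ; is-neighbour = inj₁ refl ; farther = farther })
  ... | slope₁ _ _ farther       = inj₁ (record { far = prev c ; is-neighbour = inj₂ refl ; farther = farther })
  ... | slope₂ _ farther _       = inj₁ (record { far = next c ; is-neighbour = inj₁ refl ; farther = farther })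
  ... | antipode d≡H nearer₁ nearer₂ = inj₂ (d≡H , suc-injective (trans (sym nearer₁) nearer₂))

  antipode-equidistant : ∀ c y → cd c y ≡ H → cd (next c) y ≡ cd (prev c) y
  antipode-equidistant c y d≡H with profile c y
  ... | centre d≡0 _ _             = ⊥-elim (0≢1+n (trans (sym d≡0) d≡H))
  ... | slope₁ d<H _ _             = ⊥-elim (<-irrefl d≡H d<H)
  ... | slope₂ d<H _ _             = ⊥-elim (<-irrefl d≡H d<H)
  ... | antipode _ nearer₁ nearer₂ = suc-injective (trans (sym nearer₁) nearer₂)

  record Split (c y : Fin n) : Set where
    field
      closer further : Fin n
      nearer         : Nearer closer c y
      farther        : Nearer c further y
      -- {closer, further} = {next c, prev c}
      swap           : ∀ z → cd (next c) z ≡ cd (prev c) z → cd further z ≡ cd closer z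

  equal-or-split : ∀ c y → (cd (next c) y ≡ cd (prev c) y) ⊎ Split c y
  equal-or-split c y with profile c y
  ... | centre _ farther₁ farther₂ = inj₁ (trans farther₁ (sym farther₂))
  ... | slope₁ _ nearer farther    = inj₂ (record { closer = next c ; further = prev c ; nearer = nearer ; farther = farther ; swap = λ z e → sym e })
  ... | slope₂ _ farther nearer    = inj₂ (record { closer = prev c ; further = next c ; nearer = nearer ; farther = farther ; swap = λ z e → e })
  ... | antipode _ nearer₁ nearer₂ = inj₁ (suc-injective (trans (sym nearer₁) nearer₂))

  triple : ℤ → ℕ → Fin n → ℕ → Fin n → ℕ → Fin n → List (PCV n)
  triple a o₁ c₁ o₂ c₂ o₃ c₃ = map (place a) ((suc o₁ , c₁) ∷ (suc o₂ , c₂) ∷ (suc o₃ , c₃) ∷ [])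

  private
    -- The edge from c₁ to a neighbour farther from c₂ separates the
    -- landmarks by level, since x₃ lies strictly above x₂.
    pivot-low : ∀ a o₁ o₂ o₃ c₁ c₂ c₃ → o₁ ≤ o₂ → o₂ < o₃ → Away c₁ c₂ → Confused (triple a o₁ c₁ o₂ c₂ o₃ c₃)
    pivot-low a o₁ o₂ o₃ c₁ c₂ c₃ o₁≤o₂ o₂<o₃ record { far = p ; is-neighbour = p~c₁ ; farther = c₂-nearer-c₁ }
      with bipartite c₁ p p~c₁ c₃
    ... | inj₂ c₃-nearer-p  = cut a (suc o₂) c₁ p _
      ( inj₁ (s≤s o₁≤o₂ , nearer-self c₁ p p~c₁)
      ∷ inj₁ (≤-refl , c₂-nearer-c₁)
      ∷ inj₂ (s≤s o₂<o₃ , c₃-nearer-p) ∷ [])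
    ... | inj₁ c₃-nearer-c₁ = cut a (suc o₃) c₁ p _
      ( inj₁ (s≤s (≤-trans o₁≤o₂ (<⇒≤ o₂<o₃)) , nearer-self c₁ p p~c₁)
      ∷ inj₁ (s≤s (<⇒≤ o₂<o₃) , c₂-nearer-c₁)
      ∷ inj₁ (≤-refl , c₃-nearer-c₁) ∷ [])

    -- The edge from c₂ to a neighbour farther from c₃ separates the
    -- landmarks by level, since x₁ lies strictly below x₂.
    pivot-middle : ∀ a o₁ o₂ o₃ c₁ c₂ c₃ → o₁ < o₂ → o₂ ≤ o₃ → Away c₂ c₃ → Confused (triple a o₁ c₁ o₂ c₂ o₃ c₃)
    pivot-middle a o₁ o₂ o₃ c₁ c₂ c₃ o₁<o₂ o₂≤o₃ record { far = p ; is-neighbour = p~c₂ ; farther = c₃-nearer-c₂ }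
      with bipartite c₂ p p~c₂ c₁
    ... | inj₂ c₁-nearer-p  = cut a (suc o₁) p c₂ _
      ( inj₁ (≤-refl , c₁-nearer-p)
      ∷ inj₂ (s≤s o₁<o₂ , nearer-self c₂ p p~c₂)
      ∷ inj₂ (s≤s (<-≤-trans o₁<o₂ o₂≤o₃) , c₃-nearer-c₂) ∷ [])
    ... | inj₁ c₁-nearer-c₂ = cut a (suc o₃) c₂ p _
      ( inj₁ (s≤s (≤-trans (<⇒≤ o₁<o₂) o₂≤o₃) , c₁-nearer-c₂)
      ∷ inj₁ (s≤s o₂≤o₃ , nearer-self c₂ p p~c₂)
      ∷ inj₁ (≤-refl , c₃-nearer-c₂) ∷ [])

    flat-bottom : ∀ a o₁ o₃ c₁ c₂ c₃ → o₁ < o₃ → cd (next c₁) c₂ ≡ cd (prev c₁) c₂ → Split c₁ c₃ →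
                  Confused (triple a o₁ c₁ o₁ c₂ o₃ c₃)
    flat-bottom a o₁ o₃ c₁ c₂ c₃ o₁<o₃ equal₂ S = sandwich a o₁ further closer _
      ( inj₁ (refl , swap c₁ (neighbours-equidistant c₁))
      ∷ inj₁ (refl , swap c₂ equal₂)
      ∷ inj₂ (inj₁ (s≤s o₁<o₃ , trans farther (cong suc nearer))) ∷ [])
      where open Split S

    flat-top : ∀ a o₁ o₂ c₁ c₂ c₃ → o₁ < o₂ → cd (next c₂) c₃ ≡ cd (prev c₂) c₃ → Split c₂ c₁ →
               Confused (triple a o₁ c₁ o₂ c₂ o₂ c₃)
    flat-top a o₁ o₂ c₁ c₂ c₃ o₁<o₂ equal₃ S = sandwich a o₂ closer further _
      ( inj₂ (inj₂ (o₁<o₂ , trans farther (cong suc nearer)))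
      ∷ inj₁ (refl , sym (swap c₂ (neighbours-equidistant c₂)))
      ∷ inj₁ (refl , sym (swap c₃ equal₃)) ∷ [])
      where open Split S

  ordered-triple-confused : ∀ a o₁ o₂ o₃ c₁ c₂ c₃ → o₁ ≤ o₂ → o₂ ≤ o₃ → Confused (triple a o₁ c₁ o₂ c₂ o₃ c₃)
  ordered-triple-confused a o₁ o₂ o₃ c₁ c₂ c₃ o₁≤o₂ o₂≤o₃ with m≤n⇒m<n∨m≡n o₁≤o₂ | m≤n⇒m<n∨m≡n o₂≤o₃
  ... | inj₂ refl | inj₂ refl = sandwich a o₁ c₁ c₁ _ (inj₁ (refl , refl) ∷ inj₁ (refl , refl) ∷ inj₁ (refl , refl) ∷ [])
  ... | inj₂ refl | inj₁ o₁<o₃ with away-or-antipode c₁ c₂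
  ...   | inj₁ away₂ = pivot-low a o₁ o₁ o₃ c₁ c₂ c₃ ≤-refl o₁<o₃ away₂
  ...   | inj₂ (_ , equal₂) with equal-or-split c₁ c₃
  ...     | inj₁ equal₃ = around c₁ _ (neighbours-equidistant c₁ ∷ equal₂ ∷ equal₃ ∷ [])
  ...     | inj₂ split₃ = flat-bottom a o₁ o₃ c₁ c₂ c₃ o₁<o₃ equal₂ split₃
  ordered-triple-confused a o₁ o₂ o₃ c₁ c₂ c₃ o₁≤o₂ o₂≤o₃ | inj₁ o₁<o₂ | inj₂ refl with away-or-antipode c₂ c₃
  ...   | inj₁ away₃ = pivot-middle a o₁ o₂ o₂ c₁ c₂ c₃ o₁<o₂ ≤-refl away₃
  ...   | inj₂ (_ , equal₃) with equal-or-split c₂ c₁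
  ...     | inj₁ equal₁ = around c₂ _ (equal₁ ∷ neighbours-equidistant c₂ ∷ equal₃ ∷ [])
  ...     | inj₂ split₁ = flat-top a o₁ o₂ c₁ c₂ c₃ o₁<o₂ equal₃ split₁
  ordered-triple-confused a o₁ o₂ o₃ c₁ c₂ c₃ o₁≤o₂ o₂≤o₃ | inj₁ o₁<o₂ | inj₁ o₂<o₃ with away-or-antipode c₁ c₂
  ...   | inj₁ away₂ = pivot-low a o₁ o₂ o₃ c₁ c₂ c₃ (<⇒≤ o₁<o₂) o₂<o₃ away₂
  ...   | inj₂ (antipodal , _) with away-or-antipode c₂ c₃
  ...     | inj₁ away₃ = pivot-middle a o₁ o₂ o₃ c₁ c₂ c₃ o₁<o₂ (<⇒≤ o₂<o₃) away₃
  ...     | inj₂ (_ , equal₃) = around c₂ _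
    (antipode-equidistant c₂ c₁ (trans (cdist-sym n (toℕ c₂) (toℕ c₁)) antipodal) ∷ neighbours-equidistant c₂ ∷ equal₃ ∷ [])

  private
    reordered : ∀ a i j k ci cj ck {L} → i ≤ j → j ≤ k → triple a i ci j cj k ck ↭ L → Confused L
    reordered a i j k ci cj ck i≤j j≤k reorder = confused-↭ reorder (ordered-triple-confused a i j k ci cj ck i≤j j≤k)

  triple-confused : ∀ x y z → Confused (x ∷ y ∷ z ∷ [])
  triple-confused (b₁ , c₁) (b₂ , c₂) (b₃ , c₃) with strict-base ((b₁ , c₁) ∷ (b₂ , c₂) ∷ (b₃ , c₃) ∷ [])
  ... | a , (o₁ , refl) ∷ (o₂ , refl) ∷ (o₃ , refl) ∷ [] with ≤-total o₁ o₂ | ≤-total o₂ o₃ | ≤-total o₁ o₃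
  ...   | inj₁ o₁≤o₂ | inj₁ o₂≤o₃ | _          = reordered a o₁ o₂ o₃ c₁ c₂ c₃ o₁≤o₂ o₂≤o₃ ↭-refl
  ...   | inj₁ o₁≤o₂ | inj₂ o₃≤o₂ | inj₁ o₁≤o₃ = reordered a o₁ o₃ o₂ c₁ c₃ c₂ o₁≤o₃ o₃≤o₂ (↭-prep _ (↭-swap _ _ ↭-refl))
  ...   | inj₁ o₁≤o₂ | inj₂ o₃≤o₂ | inj₂ o₃≤o₁ = reordered a o₃ o₁ o₂ c₃ c₁ c₂ o₃≤o₁ o₁≤o₂
                                                   (↭-trans (↭-swap _ _ ↭-refl) (↭-prep _ (↭-swap _ _ ↭-refl)))
  ...   | inj₂ o₂≤o₁ | inj₁ o₂≤o₃ | inj₁ o₁≤o₃ = reordered a o₂ o₁ o₃ c₂ c₁ c₃ o₂≤o₁ o₁≤o₃ (↭-swap _ _ ↭-refl)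
  ...   | inj₂ o₂≤o₁ | inj₁ o₂≤o₃ | inj₂ o₃≤o₁ = reordered a o₂ o₃ o₁ c₂ c₃ c₁ o₂≤o₃ o₃≤o₁
                                                   (↭-trans (↭-prep _ (↭-swap _ _ ↭-refl)) (↭-swap _ _ ↭-refl))
  ...   | inj₂ o₂≤o₁ | inj₂ o₃≤o₂ | _          = reordered a o₃ o₂ o₁ c₃ c₂ c₁ o₃≤o₂ o₂≤o₁
                                                   (↭-trans (↭-swap _ _ ↭-refl) (↭-trans (↭-prep _ (↭-swap _ _ ↭-refl)) (↭-swap _ _ ↭-refl)))

∣m+d-m∣ : ∀ m d → ∣ m + d - m ∣ ≡ d
∣m+d-m∣ m d = trans (∣-∣-comm (m + d) m) (∣m-m+n∣≡n m d)

-- Which half of C_{2H}, H = 1 + h, the column X lies in, as seen from 0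
-- and 1: on the half 1, …, H it is nearer to 1 than to 0 and equals its
-- distance from 0; otherwise it is farther from 1 than from 0 and is 0 or
-- lies at n minus its distance from 0.
EvenHalf : ℕ → ℕ → Set
EvenHalf h X = (d₁ ≡ suc d₀ × (X ≡ 0 ⊎ X + d₀ ≡ n)) ⊎ (d₀ ≡ suc d₁ × X ≡ d₀)
  where
  n : ℕ
  n = suc h + suc h
  d₀ : ℕ
  d₀ = cdist n 0 X
  d₁ : ℕ
  d₁ = cdist n 1 X

-- Moreover every column lies on a shortest path between 0 and H.
EvenColumn : ℕ → ℕ → Set
EvenColumn h X = (cdist (suc h + suc h) 0 X + cdist (suc h + suc h) (suc h) X ≡ suc h) × EvenHalf h X

private
  even-column-near : ∀ s k → EvenColumn (suc (s + k)) (suc s)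
  even-column-near s k = trans (cong₂ _+_ d₀≡ d-half≡) (eq₃ s k) , inj₂ (tent-up n s (≤-by (suc (suc (k + k))) (eq₁ s k)) , sym d₀≡)
    where
    n : ℕ
    n = suc (suc (s + k)) + suc (suc (s + k))
    eq₁ : ∀ s k → suc s + suc s + suc (suc (k + k)) ≡ suc (suc (s + k)) + suc (suc (s + k))
    eq₁ = ℕRing.solve-∀
    eq₃ : ∀ s k → suc s + suc k ≡ suc (suc (s + k))
    eq₃ = ℕRing.solve-∀
    eq₄ : ∀ s k → suc k + suc k + suc (suc (s + s)) ≡ suc (suc (s + k)) + suc (suc (s + k))
    eq₄ = ℕRing.solve-∀
    d₀≡ : tent n (suc s) ≡ suc s
    d₀≡ = tent-low n (suc s) (≤-by (suc (suc (k + k))) (eq₁ s k))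
    d-half≡ : tent n ∣ suc (s + k) - s ∣ ≡ suc k
    d-half≡ = trans (cong (tent n) (trans (cong (λ y → ∣ y - s ∣) (sym (+-suc s k))) (∣m+d-m∣ s (suc k))))
                    (tent-low n (suc k) (≤-by (suc (suc (s + s))) (eq₄ s k)))

  even-column-far : ∀ k j → EvenColumn (suc (k + j)) (suc (suc (suc (k + j) + k)))
  even-column-far k j = trans (cong₂ _+_ d₀≡ d-half≡) (eq₃ k j) , inj₁ (d₁≡ , inj₂ (trans (cong (λ d → X + d) d₀≡) (eq₁ k j)))
    where
    H : ℕ
    H = suc (suc (k + j))
    n : ℕ
    n = H + H
    X : ℕ
    X = suc (suc (suc (k + j) + k))
    eq₁ : ∀ k j → suc (suc (suc (k + j) + k)) + suc j ≡ suc (suc (k + j)) + suc (suc (k + j))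
    eq₁ = ℕRing.solve-∀
    eq₃ : ∀ k j → suc j + suc k ≡ suc (suc (k + j))
    eq₃ = ℕRing.solve-∀
    eq₄ : ∀ k j → suc k + suc k + suc (suc (j + j)) ≡ suc (suc (k + j)) + suc (suc (k + j))
    eq₄ = ℕRing.solve-∀
    eq₅ : ∀ k j → suc (suc (k + j)) + k + suc (suc j) ≡ suc (suc (k + j)) + suc (suc (k + j))
    eq₅ = ℕRing.solve-∀
    eq₆ : ∀ k j → suc j + suc (suc (k + k)) ≡ suc (suc (suc (k + j)) + k)
    eq₆ = ℕRing.solve-∀
    eq₇ : ∀ k j → suc (suc j) + (k + k) ≡ suc (suc (k + j)) + k
    eq₇ = ℕRing.solve-∀
    d₀≡ : tent n X ≡ suc j
    d₀≡ = tent-high n X (suc j) (eq₁ k j) (≤-by (suc (suc (k + k))) (eq₆ k j))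
    d-half≡ : tent n ∣ suc (k + j) - suc (suc (k + j) + k) ∣ ≡ suc k
    d-half≡ = trans (cong (tent n) (trans (cong (λ y → ∣ suc (k + j) - y ∣) (sym (+-suc (suc (k + j)) k))) (∣m-m+n∣≡n (suc (k + j)) (suc k))))
                    (tent-low n (suc k) (≤-by (suc (suc (j + j))) (eq₄ k j)))
    d₁≡ : tent n (suc (suc (k + j)) + k) ≡ suc (tent n X)
    d₁≡ = trans (tent-high n (suc (suc (k + j)) + k) (suc (suc j)) (eq₅ k j) (≤-by (k + k) (eq₇ k j))) (cong suc (sym d₀≡))

even-column : ∀ h X → X < suc h + suc h → EvenColumn h X
even-column h zero _ = tent-low (suc h + suc h) (suc h) ≤-refl ,
                       inj₁ (tent-low (suc h + suc h) 1 (+-mono-≤ (s≤s z≤n) (s≤s z≤n)) , inj₁ refl)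
even-column h (suc s) X<n with compare s h
... | less .s k = even-column-near s k
... | equal .h = trans (cong₂ _+_ (tent-low n (suc h) ≤-refl) (cong (tent n) (∣n-n∣≡0 h))) (+-identityʳ (suc h)) ,
                 inj₂ (tent-up n h ≤-refl , sym (tent-low n (suc h) ≤-refl))
  where
  n : ℕ
  n = suc h + suc h
... | greater .h k with m≤n⇒∃[o]m+o≡n X<n
...   | j , e rewrite sym (half-gap h k j e) = even-column-far k j

OddColumn : ℕ → ℕ → Set
OddColumn c X = (d₀ ≡ X × d₀ + cdist n c X ≡ c) ⊎ (X + d₀ ≡ n × d₀ + cdist n c X ≡ suc c)
  where
  n : ℕ
  n = suc (c + c)
  d₀ : ℕ
  d₀ = cdist n 0 X

odd-column : ∀ c X → X < suc (c + c) → OddColumn c X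
odd-column c X X<n with X ≤? c
... | yes X≤c with m≤n⇒∃[o]m+o≡n X≤c
...   | e , refl = inj₁ (d₀≡ , cong₂ _+_ d₀≡ (trans (cong (tent n) (∣m+d-m∣ X e)) (tent-low n e (≤-by (suc (X + X)) (eq₂ X e)))))
  where
  n : ℕ
  n = suc ((X + e) + (X + e))
  eq₁ : ∀ X e → X + X + suc (e + e) ≡ suc (X + e + (X + e))
  eq₁ = ℕRing.solve-∀
  eq₂ : ∀ X e → e + e + suc (X + X) ≡ suc (X + e + (X + e))
  eq₂ = ℕRing.solve-∀
  d₀≡ : tent n X ≡ X
  d₀≡ = tent-low n X (≤-by (suc (e + e)) (eq₁ X e))
odd-column c X X<n | no X≰c with m≤n⇒∃[o]m+o≡n (≰⇒> X≰c)
...   | s , refl with m≤n⇒∃[o]m+o≡n (+-cancelˡ-< c s c (≤-pred X<n))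
...     | e , refl = inj₂ (trans (cong (λ d → X + d) d₀≡) (eq₁ s e) , trans (cong₂ _+_ d₀≡ d-c≡) (eq₂ s e))
  where
  n : ℕ
  n = suc (c + c)
  eq₁ : ∀ s e → suc (suc s + e + s) + suc e ≡ suc (suc s + e + (suc s + e))
  eq₁ = ℕRing.solve-∀
  eq₂ : ∀ s e → suc e + suc s ≡ suc (suc s + e)
  eq₂ = ℕRing.solve-∀
  eq₃ : ∀ s e → suc e + suc (s + s) ≡ suc (suc s + e + s)
  eq₃ = ℕRing.solve-∀
  eq₄ : ∀ s e → suc s + suc s + suc (e + e) ≡ suc (suc s + e + (suc s + e))
  eq₄ = ℕRing.solve-∀
  d₀≡ : tent n X ≡ suc e
  d₀≡ = tent-high n X (suc e) (eq₁ s e) (≤-by (suc (s + s)) (eq₃ s e))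
  d-c≡ : tent n ∣ c - X ∣ ≡ suc s
  d-c≡ = trans (cong (tent n) (trans (cong (λ y → ∣ c - y ∣) (sym (+-suc c s))) (∣m-m+n∣≡n c (suc s))))
               (tent-low n (suc s) (≤-by (suc (e + e)) (eq₄ s e)))

private
  double-injective : ∀ a b → a + a ≡ b + b → a ≡ b
  double-injective zero    zero    _  = refl
  double-injective (suc a) (suc b) e =
    cong suc (double-injective a b (suc-injective (trans (sym (+-suc a a)) (trans (suc-injective e) (+-suc b b)))))

  double≢odd : ∀ a b → a + a ≢ suc (b + b)
  double≢odd a b e = even≢odd a b (trans (cong (λ x → a + x) (+-identityʳ a)) (trans e (cong (λ x → suc (b + x)) (sym (+-identityʳ b)))))

  add-equations : ∀ A A' {b b' c c'} → A + b ≡ A' + b' → A + c ≡ A' + c' → (A + A) + (b + c) ≡ (A' + A') + (b' + c')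
  add-equations A A' {b} {b'} {c} {c'} e₁ e₂ = trans (swap-middle A b A c) (trans (cong₂ _+_ e₁ e₂) (sym (swap-middle A' b' A' c')))
    where
    swap-middle : ∀ a b c d → (a + c) + (b + d) ≡ (a + b) + (c + d)
    swap-middle = ℕRing.solve-∀

even-separating : ∀ h A A' X X' → X < suc h + suc h → X' < suc h + suc h →
  let n = suc h + suc h in
  A + cdist n 0 X ≡ A' + cdist n 0 X' → A + cdist n (suc h) X ≡ A' + cdist n (suc h) X' →
  A + cdist n 1 X ≡ A' + cdist n 1 X' → A ≡ A' × X ≡ X'
even-separating h A A' X X' X<n X'<n e₀ e-half e₁ with even-column h X X<n | even-column h X' X'<n
... | sum , half | sum' , half' = A≡A' , column half half'
  where
  n : ℕ
  n = suc h + suc h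
  A≡A' : A ≡ A'
  A≡A' = double-injective A A' (+-cancelʳ-≡ (suc h) (A + A) (A' + A')
           (trans (cong (λ s → A + A + s) (sym sum)) (trans (add-equations A A' e₀ e-half) (cong (λ s → A' + A' + s) sum'))))
  d₀≡ : cdist n 0 X ≡ cdist n 0 X'
  d₀≡ = +-cancelˡ-≡ A _ _ (trans e₀ (cong (_+ cdist n 0 X') (sym A≡A')))
  d₁≡ : cdist n 1 X ≡ cdist n 1 X'
  d₁≡ = +-cancelˡ-≡ A _ _ (trans e₁ (cong (_+ cdist n 1 X') (sym A≡A')))
  no-loop : ∀ k → k ≢ suc (suc k)
  no-loop k = m≢1+n+m k {1}
  column : EvenHalf h X → EvenHalf h X' → X ≡ X'
  column (inj₁ (_ , inj₁ X≡0))  (inj₁ (_ , inj₁ X'≡0))  = trans X≡0 (sym X'≡0)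
  column (inj₁ (_ , inj₁ refl)) (inj₁ (_ , inj₂ around')) =
    ⊥-elim (<-irrefl (trans (sym (+-identityʳ X')) (trans (cong (λ d → X' + d) d₀≡) around')) X'<n)
  column (inj₁ (_ , inj₂ around)) (inj₁ (_ , inj₁ refl)) =
    ⊥-elim (<-irrefl (trans (sym (+-identityʳ X)) (trans (cong (λ d → X + d) (sym d₀≡)) around)) X<n)
  column (inj₁ (_ , inj₂ around)) (inj₁ (_ , inj₂ around')) =
    +-cancelʳ-≡ (cdist n 0 X') X X' (trans (cong (λ d → X + d) (sym d₀≡)) (trans around (sym around')))
  column (inj₁ (d₁≡1+d₀ , _)) (inj₂ (d₀'≡1+d₁' , _)) =
    ⊥-elim (no-loop (cdist n 1 X) (trans d₁≡1+d₀ (trans (cong suc d₀≡) (trans (cong suc d₀'≡1+d₁') (cong (λ d → suc (suc d)) (sym d₁≡))))))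
  column (inj₂ (d₀≡1+d₁ , _)) (inj₁ (d₁'≡1+d₀' , _)) =
    ⊥-elim (no-loop (cdist n 1 X') (trans d₁'≡1+d₀' (trans (cong suc (sym d₀≡)) (trans (cong suc d₀≡1+d₁) (cong (λ d → suc (suc d)) d₁≡)))))
  column (inj₂ (_ , X≡d₀)) (inj₂ (_ , X'≡d₀')) = trans X≡d₀ (trans d₀≡ (sym X'≡d₀'))

odd-separating : ∀ c A A' X X' → X < suc (c + c) → X' < suc (c + c) →
  let n = suc (c + c) in
  A + cdist n 0 X ≡ A' + cdist n 0 X' → A + cdist n c X ≡ A' + cdist n c X' → A ≡ A' × X ≡ X'
odd-separating c A A' X X' X<n X'<n e₀ e-c = decide (odd-column c X X<n) (odd-column c X' X'<n)
  where
  n : ℕ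
  n = suc (c + c)
  totals : ∀ {s s'} → cdist n 0 X + cdist n c X ≡ s → cdist n 0 X' + cdist n c X' ≡ s' → A + A + s ≡ A' + A' + s'
  totals sum sum' = trans (cong (λ t → A + A + t) (sym sum)) (trans (add-equations A A' e₀ e-c) (cong (λ t → A' + A' + t) sum'))
  d₀≡ : A ≡ A' → cdist n 0 X ≡ cdist n 0 X'
  d₀≡ refl = +-cancelˡ-≡ A _ _ e₀
  decide : OddColumn c X → OddColumn c X' → A ≡ A' × X ≡ X'
  decide (inj₁ (d₀≡X , sum)) (inj₁ (d₀'≡X' , sum')) = A≡A' , trans (sym d₀≡X) (trans (d₀≡ A≡A') d₀'≡X')
    where
    A≡A' : A ≡ A'
    A≡A' = double-injective A A' (+-cancelʳ-≡ c (A + A) (A' + A') (totals sum sum'))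
  decide (inj₂ (around , sum)) (inj₂ (around' , sum')) =
    A≡A' , +-cancelʳ-≡ (cdist n 0 X') X X' (trans (cong (λ d → X + d) (sym (d₀≡ A≡A'))) (trans around (sym around')))
    where
    A≡A' : A ≡ A'
    A≡A' = double-injective A A' (+-cancelʳ-≡ (suc c) (A + A) (A' + A') (totals sum sum'))
  decide (inj₁ (_ , sum)) (inj₂ (_ , sum')) =
    ⊥-elim (double≢odd A A' (+-cancelʳ-≡ c (A + A) (suc (A' + A')) (trans (totals sum sum') (+-suc (A' + A') c))))
  decide (inj₂ (_ , sum)) (inj₁ (_ , sum')) =
    ⊥-elim (double≢odd A' A (+-cancelʳ-≡ c (A' + A') (suc (A + A)) (trans (sym (totals sum sum')) (+-suc (A + A) c))))

-- c + c in the form expected by the division lemmas.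
double : ∀ c → c + c ≡ c * 2
double c = trans (cong (λ x → c + x) (sym (+-identityʳ c))) (*-comm 2 c)

module OddCase (c : ℕ) (1≤c : 1 ≤ c) where

  private
    2≤m : 2 ≤ c + c
    2≤m = +-mono-≤ 1≤c 1≤c

  open Grid (c + c) 2≤m
  open Confusion (c + c) 2≤m

  odd-landmarks : Fin n → Fin n → List (PCV n)
  odd-landmarks z ĉ = (+ 0 , z) ∷ (+ 0 , ĉ) ∷ (+ 1 , z) ∷ []

  odd-resolving : ∀ z ĉ → toℕ z ≡ 0 → toℕ ĉ ≡ c → Resolving (PCAdj n) (odd-landmarks z ĉ)
  odd-resolving z ĉ z≡0 ĉ≡c = separating⇒resolving (odd-landmarks z ĉ) separating
    where
    separating : ∀ u v → Twins (odd-landmarks z ĉ) u v → u ≡ v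
    separating (a , i) (a' , i') (e₀ ∷ e-c ∷ e₀' ∷ []) = level-and-column a i a' i' z≡0 (proj₁ same) (proj₂ same) e₀'
      where
      same : ∣ a ℤ.- 0ℤ ∣ ≡ ∣ a' ℤ.- 0ℤ ∣ × toℕ i ≡ toℕ i'
      same = odd-separating c _ _ (toℕ i) (toℕ i') (toℕ<n i) (toℕ<n i') (seen-from a i a' i' 0ℤ 0 z≡0 e₀) (seen-from a i a' i' 0ℤ c ĉ≡c e-c)

  odd-unique : ∀ z ĉ → toℕ z ≡ 0 → toℕ ĉ ≡ c → Unique (odd-landmarks z ĉ)
  odd-unique z ĉ z≡0 ĉ≡c =
      (columns-differ z≡0 ĉ≡c (<⇒≢ 1≤c) ∷ levels-differ (λ ()) ∷ [])
    ∷ (levels-differ (λ ()) ∷ [])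
    ∷ [] ∷ []

  odd-basis : ∀ z ĉ → toℕ z ≡ 0 → toℕ ĉ ≡ c → IsMetricBasis (PCAdj n) (odd-landmarks z ĉ)
  odd-basis z ĉ z≡0 ĉ≡c = odd-unique z ĉ z≡0 ĉ≡c , odd-resolving z ĉ z≡0 ĉ≡c , resolving-length 2 (0ℤ , z) pairs
    where
    pairs : ∀ L → length L ≡ 2 → Confused L
    pairs (x ∷ y ∷ []) refl = pair-confused x y

  odd-case : MetricDim (PCAdj n) 3 ×
             (∀ z ĉ → toℕ z ≡ 0 → toℕ ĉ ≡ (c + c) / 2 → IsMetricBasis (PCAdj n) (odd-landmarks z ĉ))
  odd-case = (odd-landmarks Fin.zero ĉ , odd-basis Fin.zero ĉ refl (toℕ-fromℕ< c<n) , refl) ,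
             λ z ĉ z≡0 ĉ≡ → odd-basis z ĉ z≡0 (trans ĉ≡ half)
    where
    c<n : c < n
    c<n = s≤s (m≤m+n c c)
    ĉ : Fin n
    ĉ = fromℕ< c<n
    half : (c + c) / 2 ≡ c
    half = trans (cong (_/ 2) (double c)) (m*n/n≡m c 2)

module EvenCase (h : ℕ) (1≤h : 1 ≤ h) where

  private
    2≤m : 2 ≤ h + suc h
    2≤m = ≤-trans (s≤s 1≤h) (m≤n+m (suc h) h)

  open Grid (h + suc h) 2≤m
  open Confusion (h + suc h) 2≤m
  open EvenConfusion h 1≤h using (triple-confused)

  even-landmarks : Fin n → Fin n → Fin n → List (PCV n)
  even-landmarks z ĥ o = (+ 0 , z) ∷ (+ 0 , ĥ) ∷ (+ 0 , o) ∷ (+ 1 , z) ∷ []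

  even-resolving : ∀ z ĥ o → toℕ z ≡ 0 → toℕ ĥ ≡ suc h → toℕ o ≡ 1 → Resolving (PCAdj n) (even-landmarks z ĥ o)
  even-resolving z ĥ o z≡0 ĥ≡H o≡1 = separating⇒resolving (even-landmarks z ĥ o) separating
    where
    separating : ∀ u v → Twins (even-landmarks z ĥ o) u v → u ≡ v
    separating (a , i) (a' , i') (e₀ ∷ e-half ∷ e₁ ∷ e₀' ∷ []) = level-and-column a i a' i' z≡0 (proj₁ same) (proj₂ same) e₀'
      where
      same : ∣ a ℤ.- 0ℤ ∣ ≡ ∣ a' ℤ.- 0ℤ ∣ × toℕ i ≡ toℕ i'
      same = even-separating h _ _ (toℕ i) (toℕ i') (toℕ<n i) (toℕ<n i')
               (seen-from a i a' i' 0ℤ 0 z≡0 e₀) (seen-from a i a' i' 0ℤ (suc h) ĥ≡H e-half) (seen-from a i a' i' 0ℤ 1 o≡1 e₁)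

  even-unique : ∀ z ĥ o → toℕ z ≡ 0 → toℕ ĥ ≡ suc h → toℕ o ≡ 1 → Unique (even-landmarks z ĥ o)
  even-unique z ĥ o z≡0 ĥ≡H o≡1 =
      (columns-differ z≡0 ĥ≡H (λ ()) ∷ columns-differ z≡0 o≡1 (λ ()) ∷ levels-differ (λ ()) ∷ [])
    ∷ (columns-differ ĥ≡H o≡1 (λ H≡1 → <⇒≢ (s≤s 1≤h) (sym H≡1)) ∷ levels-differ (λ ()) ∷ [])
    ∷ (levels-differ (λ ()) ∷ [])
    ∷ [] ∷ []

  even-basis : ∀ z ĥ o → toℕ z ≡ 0 → toℕ ĥ ≡ suc h → toℕ o ≡ 1 → IsMetricBasis (PCAdj n) (even-landmarks z ĥ o)
  even-basis z ĥ o z≡0 ĥ≡H o≡1 =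
    even-unique z ĥ o z≡0 ĥ≡H o≡1 , even-resolving z ĥ o z≡0 ĥ≡H o≡1 , resolving-length 3 (0ℤ , z) triples
    where
    triples : ∀ L → length L ≡ 3 → Confused L
    triples (x ∷ y ∷ z ∷ []) refl = triple-confused x y z

  even-case : MetricDim (PCAdj n) 4 ×
              (∀ z ĥ o → toℕ z ≡ 0 → toℕ ĥ ≡ (suc h + suc h) / 2 → toℕ o ≡ 1 → IsMetricBasis (PCAdj n) (even-landmarks z ĥ o))
  even-case = (even-landmarks Fin.zero ĥ o , even-basis Fin.zero ĥ o refl (toℕ-fromℕ< H<n) (toℕ-fromℕ< 1<n) , refl) ,
              λ z ĥ o z≡0 ĥ≡ o≡1 → even-basis z ĥ o z≡0 (trans ĥ≡ half) o≡1
    where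
    H<n : suc h < n
    H<n = s≤s (m≤n+m (suc h) h)
    ĥ o : Fin n
    ĥ = fromℕ< H<n
    o = fromℕ< 1<n
    half : (suc h + suc h) / 2 ≡ suc h
    half = trans (cong (_/ 2) (double (suc h))) (m*n/n≡m (suc h) 2)

OddStatement : ℕ → Set
OddStatement n =
  MetricDim (PCAdj n) 3 ×
  (∀ (z c : Fin n) → toℕ z ≡ 0 → toℕ c ≡ (n ∸ 1) / 2 →
     IsMetricBasis (PCAdj n) ((+ 0 , z) ∷ (+ 0 , c) ∷ (+ 1 , z) ∷ []))

EvenStatement : ℕ → Set
EvenStatement n =
  MetricDim (PCAdj n) 4 ×
  (∀ (z h o : Fin n) → toℕ z ≡ 0 → toℕ h ≡ n / 2 → toℕ o ≡ 1 →
     IsMetricBasis (PCAdj n) ((+ 0 , z) ∷ (+ 0 , h) ∷ (+ 0 , o) ∷ (+ 1 , z) ∷ []))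

private
  odd-shape : ∀ n → n % 2 ≡ 1 → n ≡ suc (n / 2 + n / 2)
  odd-shape n n%2≡1 = trans (m≡m%n+[m/n]*n n 2) (trans (cong (_+ (n / 2) * 2) n%2≡1) (cong suc (sym (double (n / 2)))))

  even-shape : ∀ n → n % 2 ≡ 0 → n ≡ n / 2 + n / 2
  even-shape n n%2≡0 = trans (m≡m%n+[m/n]*n n 2) (trans (cong (_+ (n / 2) * 2) n%2≡0) (sym (double (n / 2))))

  odd-statement : ∀ n c → 3 ≤ n → n ≡ suc (c + c) → OddStatement n
  odd-statement n zero    3≤n n≡1 = ⊥-elim (<-irrefl refl (≤-<-trans 3≤n (subst (_< 3) (sym n≡1) (s≤s (s≤s z≤n)))))
  odd-statement n (suc c) 3≤n refl = OddCase.odd-case (suc c) (s≤s z≤n)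

  even-statement : ∀ n h → 3 ≤ n → n ≡ h + h → EvenStatement n
  even-statement n zero          3≤n n≡0 = ⊥-elim (<-irrefl refl (≤-<-trans 3≤n (subst (_< 3) (sym n≡0) (s≤s z≤n))))
  even-statement n (suc zero)    3≤n n≡2 = ⊥-elim (<-irrefl refl (≤-<-trans 3≤n (subst (_< 3) (sym n≡2) ≤-refl)))
  even-statement n (suc (suc h)) 3≤n refl = EvenCase.even-case (suc h) (s≤s z≤n)

proposition7 : ∀ (n : ℕ) → 3 ≤ n →
    ((n % 2 ≡ 1 →
        MetricDim (PCAdj n) 3 ×
        (∀ (z c : Fin n) → toℕ z ≡ 0 → toℕ c ≡ (n ∸ 1) / 2 →
           IsMetricBasis (PCAdj n) ((+ 0 , z) ∷ (+ 0 , c) ∷ (+ 1 , z) ∷ [])))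
    × (n % 2 ≡ 0 →
        MetricDim (PCAdj n) 4 ×
        (∀ (z h o : Fin n) → toℕ z ≡ 0 → toℕ h ≡ n / 2 → toℕ o ≡ 1 →
           IsMetricBasis (PCAdj n) ((+ 0 , z) ∷ (+ 0 , h) ∷ (+ 0 , o) ∷ (+ 1 , z) ∷ []))))
proposition7 n 3≤n =
  (λ n-odd  → odd-statement  n (n / 2) 3≤n (odd-shape n n-odd)) ,
  (λ n-even → even-statement n (n / 2) 3≤n (even-shape n n-even))
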